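{- Let $G$ be a finite triangle-free graph of maximum degree $\Delta$. Then \[ \chi_f(G) \le 1 + \min_{k\in \mathbb{N}} \inf_{\lambda>0} \frac{(1+\lambda)^k+\lambda(1+\lambda)\Delta}{\lambda(1+k\lambda)}, \] where $\mathbb{N}$ denotes the positive integers.
   Context: The fractional chromatic number $\chi_f(G)$ of a graph $G$ is the minimum of $\sum_{I} w_I$ over all assignments of weights $w_I\in[0,1]$ to the maximal independent sets $I$ of $G$ such that for every vertex $v$, $\sum_{I\ni v} w_I \ge 1$.
   Formalization: The parameter λ ranges over the positive rationals rather than all real λ > 0, and the weights $w_I$ are taken in the rationals. -}

module Defs where

open import Data.Bool using (Bool; true; false; if_then_else_)
open import Data.Nat as ℕ using (ℕ; zero; suc; _⊔_)
open import Data.Fin using (Fin)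
open import Data.Vec using (Vec; []; _∷_; lookup)
open import Data.List using (List; []; _∷_; map; _++_; foldr; allFin)
open import Data.Nat.ListAction using (sum)
open import Data.Fin.Subset using (Subset; _∈_; _∉_; _⊆_)
open import Data.Product using (Σ; _×_; _,_)
open import Data.Empty using (⊥)
open import Relation.Nullary using (¬_)
open import Relation.Binary.PropositionalEquality using (_≡_)
open import Data.Rational as ℚ using (ℚ; 0ℚ; 1ℚ; NonZero; Positive; NonNegative)
open import Data.Rational.Properties
  using (pos⇒nonZero; pos*pos⇒pos; pos+nonNeg⇒pos; nonNeg+nonNeg⇒nonNeg; nonNeg*nonNeg⇒nonNeg; pos⇒nonNeg)

record Graph (n : ℕ) : Set where
  field
    adj   : Fin n → Fin n → Bool
    sym   : ∀ u v → adj u v ≡ adj v u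
    irrefl : ∀ v → adj v v ≡ false
open Graph public

TriangleFree : ∀ {n} → Graph n → Set
TriangleFree G = ∀ u v w → adj G u v ≡ true → adj G v w ≡ true → adj G u w ≡ true → ⊥

degree : ∀ {n} → Graph n → Fin n → ℕ
degree {n} G v = sum (map (λ u → if adj G v u then 1 else 0) (allFin n))

-- maximum degree (0 for the empty graph)
maxDegree : ∀ {n} → Graph n → ℕ
maxDegree {n} G = foldr _⊔_ 0 (map (degree G) (allFin n))

Independent : ∀ {n} → Graph n → Subset n → Set
Independent G S = ∀ u v → u ∈ S → v ∈ S → adj G u v ≡ false

MaximalIndependent : ∀ {n} → Graph n → Subset n → Set
MaximalIndependent G S = Independent G S × (∀ T → Independent G T → S ⊆ T → T ≡ S)

allSubsets : ∀ n → List (Subset n)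
allSubsets zero = [] ∷ []
allSubsets (suc n) = map (false ∷_) (allSubsets n) ++ map (true ∷_) (allSubsets n)

sumℚ : List ℚ → ℚ
sumℚ = foldr ℚ._+_ 0ℚ

record FractionalColouring {n} (G : Graph n) : Set where
  field
    w        : Subset n → ℚ
    w≥0      : ∀ I → 0ℚ ℚ.≤ w I
    w≤1      : ∀ I → w I ℚ.≤ 1ℚ
    support  : ∀ I → ¬ (w I ≡ 0ℚ) → MaximalIndependent G I
    covers   : ∀ v → 1ℚ ℚ.≤ sumℚ (map (λ I → if lookup I v then w I else 0ℚ) (allSubsets n))
open FractionalColouring public

totalWeight : ∀ {n} {G : Graph n} → FractionalColouring G → ℚ
totalWeight {n} c = sumℚ (map (w c) (allSubsets n))

-- χ_f(G) ≤ x  (the minimum in the definition of χ_f is attained, so this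
-- says some fractional colouring has total weight ≤ x)
χf≤ : ∀ {n} → Graph n → ℚ → Set
χf≤ G x = Σ (FractionalColouring G) (λ c → totalWeight c ℚ.≤ x)

_^ℚ_ : ℚ → ℕ → ℚ
q ^ℚ zero = 1ℚ
q ^ℚ suc k = q ℚ.* (q ^ℚ k)

ℕ→ℚ : ℕ → ℚ
ℕ→ℚ zero = 0ℚ
ℕ→ℚ (suc k) = 1ℚ ℚ.+ ℕ→ℚ k

ℕ→ℚ-nonNeg : ∀ k → NonNegative (ℕ→ℚ k)
ℕ→ℚ-nonNeg zero = _
ℕ→ℚ-nonNeg (suc k) = nonNeg+nonNeg⇒nonNeg 1ℚ (ℕ→ℚ k) {{ℕ→ℚ-nonNeg k}}

denom-pos : ∀ k t → .{{_ : Positive t}} → Positive (t ℚ.* (1ℚ ℚ.+ ℕ→ℚ k ℚ.* t))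
denom-pos k t = pos*pos⇒pos t (1ℚ ℚ.+ ℕ→ℚ k ℚ.* t)
  {{pos+nonNeg⇒pos 1ℚ (ℕ→ℚ k ℚ.* t)
     {{nonNeg*nonNeg⇒nonNeg (ℕ→ℚ k) {{ℕ→ℚ-nonNeg k}} t {{pos⇒nonNeg t}}}}}}

bound : (Δ k : ℕ) (t : ℚ) → .{{_ : Positive t}} → ℚ
bound Δ k t =
  1ℚ ℚ.+ ((((1ℚ ℚ.+ t) ^ℚ k) ℚ.+ t ℚ.* (1ℚ ℚ.+ t) ℚ.* ℕ→ℚ Δ)
           ℚ.÷ (t ℚ.* (1ℚ ℚ.+ ℕ→ℚ k ℚ.* t))) {{pos⇒nonZero (t ℚ.* (1ℚ ℚ.+ ℕ→ℚ k ℚ.* t)) {{denom-pos k t}}}}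

module Submission where

-- Fix k ∈ ℕ and the fugacity λ = t > 0; put D = t(1+kt), a = D + (1+t)^k and
-- b = t(1+t).  For H ⊆ V the hard-core model gives each independent I ⊆ H
-- the weight t^|I|; Z(H) is its partition function and occ_H(u) = Σ_{I ∋ u} t^|I|.
--
--  1. Local occupancy (module LocalOccupancy).  If G is triangle-free and
--     v ∈ H then  D · Z(H) ≤ a · occ_H(v) + b · Σ_{u ∼ v} occ_H(u).
--     Writing I = J ∪ K with J ∩ N[v] = ∅, K ⊆ N[v], the sum over K for fixed
--     J reduces to binomial sums over the free neighbours Y(J) of v, which are
--     pairwise non-adjacent since G has no triangle; their nonnegativity is
--     the inequality (1+kt)(1+t)^y ≤ (1+t)^k + yt(1+t)^y.
--  2. Greedy covering (module GreedyCovering).  Starting from the demand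
--     d ≡ 1, repeatedly subtract the largest multiple of occ_H, H = supp d,
--     that keeps d ≥ 0.  The result covers every vertex exactly once by
--     independent sets, and by (1) its total weight W satisfies
--     D · W ≤ a · d(v) + b · Σ_{u ∼ v} d(u) ≤ a + bΔ for some vertex v.
--  3. Pushing the weights onto maximal extensions and capping them at 1
--     (module ColouringFromCover) gives a fractional colouring of weight
--     ≤ W ≤ 1 + ((1+t)^k + t(1+t)Δ)/(t(1+kt)).

module HardCoreColouring where

  open import Data.Bool using (Bool; true; false; if_then_else_; _∧_; _∨_; not)
  open import Data.Nat as ℕ using (ℕ; zero; suc; z≤n; s≤s)
  import Data.Nat.Properties as ℕP
  open import Data.Nat.ListAction using () renaming (sum to sumℕ)
  open import Data.Fin as Fin using (Fin; zero; suc)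
  open import Data.Fin.Subset using (Subset; _⊆_)
  open import Data.Vec using ([]; _∷_; lookup; tabulate)
  open import Data.Vec.Properties
    using (lookup∘tabulate; tabulate∘lookup; tabulate-cong; []=⇒lookup; lookup⇒[]=)
  open import Data.List using (List; []; _∷_; map; _++_; foldr; allFin)
  open import Data.List.Properties using (map-tabulate)
  open import Data.List.Membership.Propositional using (_∈_)
  open import Data.List.Membership.Propositional.Properties using (∈-allFin)
  open import Data.List.Relation.Unary.Any using (here; there)
  open import Data.Product using (Σ; _×_; _,_; proj₁; proj₂)
  open import Data.Sum using (_⊎_; inj₁; inj₂)
  open import Data.Empty using (⊥; ⊥-elim)
  open import Relation.Nullary using (¬_; yes; no)
  open import Relation.Nullary.Decidable using (⌊_⌋)
  open import Relation.Binary.PropositionalEquality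
  open import Data.Rational hiding (floor)   -- its notation ⌊_⌋ would clash with Dec's
  open import Data.Rational.Properties
  open import Data.Rational.Solver
  open +-*-Solver using (solve; _:=_; con; _:+_; _:*_; _:-_)
  open import Defs hiding (sym; w; w≥0; w≤1; support; covers)

  0≤+ : ∀ {a b} → 0ℚ ≤ a → 0ℚ ≤ b → 0ℚ ≤ a + b
  0≤+ p q = +-mono-≤ p q

  0≤* : ∀ {a b} → 0ℚ ≤ a → 0ℚ ≤ b → 0ℚ ≤ a * b
  0≤* {a} {b} p q = nonNegative⁻¹ (a * b) {{nonNeg*nonNeg⇒nonNeg a {{nonNegative p}} b {{nonNegative q}}}}

  0≤1 : 0ℚ ≤ 1ℚ
  0≤1 = nonNegative⁻¹ 1ℚ

  *-monoˡ-≤-0≤ : ∀ {r a b} → 0ℚ ≤ r → a ≤ b → r * a ≤ r * b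
  *-monoˡ-≤-0≤ {r} p q = *-monoˡ-≤-nonNeg r {{nonNegative p}} q

  *-monoʳ-≤-0≤ : ∀ {r a b} → 0ℚ ≤ r → a ≤ b → a * r ≤ b * r
  *-monoʳ-≤-0≤ {r} p q = *-monoʳ-≤-nonNeg r {{nonNegative p}} q

  0≤-⇒≤ : ∀ {a b} → 0ℚ ≤ b - a → a ≤ b
  0≤-⇒≤ {a} {b} p = begin
    a           ≡⟨ sym (+-identityʳ a) ⟩
    a + 0ℚ      ≤⟨ +-monoʳ-≤ a p ⟩
    a + (b - a) ≡⟨ solve 2 (λ a b → a :+ (b :- a) := b) refl a b ⟩
    b           ∎
    where open ≤-Reasoning

  ≤⇒0≤- : ∀ {a b} → a ≤ b → 0ℚ ≤ b - a
  ≤⇒0≤- {a} {b} p = begin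
    0ℚ    ≡⟨ sym (+-inverseʳ a) ⟩
    a - a ≤⟨ +-monoˡ-≤ (- a) p ⟩
    b - a ∎
    where open ≤-Reasoning

  -- Truncation at 1 is subadditive on nonnegative numbers; this is what lets
  -- us cap the weights of a fractional colouring at 1 without losing coverage.
  1⊓-subadditive : ∀ {a b} → 0ℚ ≤ a → 0ℚ ≤ b → 1ℚ ⊓ (a + b) ≤ (1ℚ ⊓ a) + (1ℚ ⊓ b)
  1⊓-subadditive {a} {b} pa pb with ≤-total 1ℚ a | ≤-total 1ℚ b
  ... | inj₁ 1≤a | _ = begin
    1ℚ ⊓ (a + b)      ≤⟨ p⊓q≤p 1ℚ (a + b) ⟩
    1ℚ                ≡⟨ sym (p≤q⇒p⊓q≡p 1≤a) ⟩
    1ℚ ⊓ a            ≡⟨ sym (+-identityʳ _) ⟩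
    1ℚ ⊓ a + 0ℚ       ≤⟨ +-monoʳ-≤ (1ℚ ⊓ a) (⊓-glb 0≤1 pb) ⟩
    1ℚ ⊓ a + 1ℚ ⊓ b   ∎
    where open ≤-Reasoning
  ... | inj₂ _ | inj₁ 1≤b = begin
    1ℚ ⊓ (a + b)      ≤⟨ p⊓q≤p 1ℚ (a + b) ⟩
    1ℚ                ≡⟨ sym (p≤q⇒p⊓q≡p 1≤b) ⟩
    1ℚ ⊓ b            ≡⟨ sym (+-identityˡ _) ⟩
    0ℚ + 1ℚ ⊓ b       ≤⟨ +-monoˡ-≤ (1ℚ ⊓ b) (⊓-glb 0≤1 pa) ⟩
    1ℚ ⊓ a + 1ℚ ⊓ b   ∎
    where open ≤-Reasoning
  ... | inj₂ a≤1 | inj₂ b≤1 = begin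
    1ℚ ⊓ (a + b)      ≤⟨ p⊓q≤q 1ℚ (a + b) ⟩
    a + b             ≡⟨ sym (cong₂ _+_ (p≥q⇒p⊓q≡q a≤1) (p≥q⇒p⊓q≡q b≤1)) ⟩
    1ℚ ⊓ a + 1ℚ ⊓ b   ∎
    where open ≤-Reasoning

  0≤if : ∀ (b : Bool) {x} → 0ℚ ≤ x → 0ℚ ≤ (if b then x else 0ℚ)
  0≤if true p = p
  0≤if false p = ≤-refl

  if-0 : ∀ (b : Bool) → (if b then 0ℚ else 0ℚ) ≡ 0ℚ
  if-0 true = refl
  if-0 false = refl

  if-* : ∀ (b : Bool) c x → (if b then c * x else 0ℚ) ≡ c * (if b then x else 0ℚ)
  if-* true c x = refl
  if-* false c x = sym (*-zeroʳ c)

  if-+ : ∀ (b : Bool) x y → (if b then x + y else 0ℚ) ≡ (if b then x else 0ℚ) + (if b then y else 0ℚ)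
  if-+ true x y = refl
  if-+ false x y = refl

  if-swap : ∀ (b c : Bool) (x : ℚ) →
    (if b then (if c then x else 0ℚ) else 0ℚ) ≡ (if c then (if b then x else 0ℚ) else 0ℚ)
  if-swap true true x = refl
  if-swap true false x = refl
  if-swap false true x = refl
  if-swap false false x = refl

  ℕ→ℚ-0≤ : ∀ m → 0ℚ ≤ ℕ→ℚ m
  ℕ→ℚ-0≤ zero = ≤-refl
  ℕ→ℚ-0≤ (suc m) = 0≤+ 0≤1 (ℕ→ℚ-0≤ m)

  ℕ→ℚ-+ : ∀ a b → ℕ→ℚ (a ℕ.+ b) ≡ ℕ→ℚ a + ℕ→ℚ b
  ℕ→ℚ-+ zero b = sym (+-identityˡ _)
  ℕ→ℚ-+ (suc a) b = trans (cong (1ℚ +_) (ℕ→ℚ-+ a b)) (sym (+-assoc 1ℚ (ℕ→ℚ a) (ℕ→ℚ b)))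

  ℕ→ℚ-mono : ∀ {a b} → a ℕ.≤ b → ℕ→ℚ a ≤ ℕ→ℚ b
  ℕ→ℚ-mono {b = b} z≤n = ℕ→ℚ-0≤ b
  ℕ→ℚ-mono (s≤s p) = +-monoʳ-≤ 1ℚ (ℕ→ℚ-mono p)

  ^ℚ-0≤ : ∀ {x} → 0ℚ ≤ x → ∀ m → 0ℚ ≤ x ^ℚ m
  ^ℚ-0≤ x≥0 zero = 0≤1
  ^ℚ-0≤ x≥0 (suc m) = 0≤* x≥0 (^ℚ-0≤ x≥0 m)

  ^ℚ-+ : ∀ (x : ℚ) a b → x ^ℚ (a ℕ.+ b) ≡ (x ^ℚ a) * (x ^ℚ b)
  ^ℚ-+ x zero b = sym (*-identityˡ _)
  ^ℚ-+ x (suc a) b = trans (cong (x *_) (^ℚ-+ x a b)) (sym (*-assoc x _ _))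

  module _ {A : Set} where

    sum-+ : ∀ (xs : List A) f g → sumℚ (map (λ a → f a + g a) xs) ≡ sumℚ (map f xs) + sumℚ (map g xs)
    sum-+ [] f g = refl
    sum-+ (x ∷ xs) f g = trans (cong (f x + g x +_) (sum-+ xs f g))
      (solve 4 (λ a b s t → (a :+ b) :+ (s :+ t) := (a :+ s) :+ (b :+ t)) refl
        (f x) (g x) (sumℚ (map f xs)) (sumℚ (map g xs)))

    sum-- : ∀ (xs : List A) f g → sumℚ (map (λ a → f a - g a) xs) ≡ sumℚ (map f xs) - sumℚ (map g xs)
    sum-- [] f g = refl
    sum-- (x ∷ xs) f g = trans (cong (f x - g x +_) (sum-- xs f g))
      (solve 4 (λ a b s t → (a :- b) :+ (s :- t) := (a :+ s) :- (b :+ t)) refl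
        (f x) (g x) (sumℚ (map f xs)) (sumℚ (map g xs)))

    sum-* : ∀ (xs : List A) c f → sumℚ (map (λ a → c * f a) xs) ≡ c * sumℚ (map f xs)
    sum-* [] c f = sym (*-zeroʳ c)
    sum-* (x ∷ xs) c f = trans (cong (c * f x +_) (sum-* xs c f)) (sym (*-distribˡ-+ c (f x) (sumℚ (map f xs))))

    sum-cong : ∀ (xs : List A) {f g} → (∀ a → f a ≡ g a) → sumℚ (map f xs) ≡ sumℚ (map g xs)
    sum-cong [] e = refl
    sum-cong (x ∷ xs) e = cong₂ _+_ (e x) (sum-cong xs e)

    sum-mono : ∀ (xs : List A) {f g} → (∀ a → f a ≤ g a) → sumℚ (map f xs) ≤ sumℚ (map g xs)
    sum-mono [] e = ≤-refl
    sum-mono (x ∷ xs) e = +-mono-≤ (e x) (sum-mono xs e)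

    sum-0 : ∀ (xs : List A) {f} → (∀ a → f a ≡ 0ℚ) → sumℚ (map f xs) ≡ 0ℚ
    sum-0 [] e = refl
    sum-0 (x ∷ xs) e = trans (cong₂ _+_ (e x) (sum-0 xs e)) (+-identityʳ 0ℚ)

    sum-0≤ : ∀ (xs : List A) {f} → (∀ a → 0ℚ ≤ f a) → 0ℚ ≤ sumℚ (map f xs)
    sum-0≤ [] e = ≤-refl
    sum-0≤ (x ∷ xs) e = 0≤+ (e x) (sum-0≤ xs e)

    sum-++ : ∀ (xs ys : List A) f → sumℚ (map f (xs ++ ys)) ≡ sumℚ (map f xs) + sumℚ (map f ys)
    sum-++ [] ys f = sym (+-identityˡ _)
    sum-++ (x ∷ xs) ys f = trans (cong (f x +_) (sum-++ xs ys f)) (sym (+-assoc (f x) _ _))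

    sum-nonzero : ∀ (xs : List A) {f} → ¬ (sumℚ (map f xs) ≡ 0ℚ) → Σ A (λ a → ¬ (f a ≡ 0ℚ))
    sum-nonzero [] ne = ⊥-elim (ne refl)
    sum-nonzero (x ∷ xs) {f} ne with f x ≟ 0ℚ
    ... | no fx≢0 = x , fx≢0
    ... | yes fx≡0 = sum-nonzero xs (λ rest≡0 → ne (trans (cong₂ _+_ fx≡0 rest≡0) (+-identityʳ 0ℚ)))

    sum-1⊓ : ∀ (xs : List A) {f} → (∀ a → 0ℚ ≤ f a) → 1ℚ ⊓ sumℚ (map f xs) ≤ sumℚ (map (λ a → 1ℚ ⊓ f a) xs)
    sum-1⊓ [] e = p⊓q≤q 1ℚ 0ℚ
    sum-1⊓ (x ∷ xs) {f} e = ≤-trans (1⊓-subadditive (e x) (sum-0≤ xs e)) (+-monoʳ-≤ (1ℚ ⊓ f x) (sum-1⊓ xs e))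

  module _ {A B : Set} where

    sum-map : ∀ (xs : List B) (g : B → A) f → sumℚ (map f (map g xs)) ≡ sumℚ (map (λ b → f (g b)) xs)
    sum-map [] g f = refl
    sum-map (x ∷ xs) g f = cong (f (g x) +_) (sum-map xs g f)

    sum-swap : ∀ (xs : List A) (ys : List B) (f : A → B → ℚ) →
      sumℚ (map (λ a → sumℚ (map (f a) ys)) xs) ≡ sumℚ (map (λ b → sumℚ (map (λ a → f a b) xs)) ys)
    sum-swap [] ys f = sym (sum-0 ys (λ _ → refl))
    sum-swap (x ∷ xs) ys f =
      trans (cong (sumℚ (map (f x) ys) +_) (sum-swap xs ys f))
            (sym (sum-+ ys (f x) (λ b → sumℚ (map (λ a → f a b) xs))))

  -- Every set-theoretic condition we sum
  -- over gets a Boolean test with soundness/completeness lemmas, so that an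
  -- indicator sum Σ_{S : P S} f S is written  Σs (λ S → if P? S then f S else 0).

  t≢f : true ≢ false
  t≢f ()

  Σs : ∀ {n} → (Subset n → ℚ) → ℚ
  Σs {n} f = sumℚ (map f (allSubsets n))

  Σv : ∀ {n} → (Fin n → ℚ) → ℚ
  Σv {n} f = sumℚ (map f (allFin n))

  Σs-suc : ∀ {n} (f : Subset (suc n) → ℚ) → Σs f ≡ Σs (λ S → f (false ∷ S)) + Σs (λ S → f (true ∷ S))
  Σs-suc {n} f = trans (sum-++ (map (false ∷_) (allSubsets n)) _ f)
    (cong₂ _+_ (sum-map (allSubsets n) (false ∷_) f) (sum-map (allSubsets n) (true ∷_) f))

  Σs-cong : ∀ {n} {f g : Subset n → ℚ} → (∀ S → f S ≡ g S) → Σs f ≡ Σs g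
  Σs-cong {n} = sum-cong (allSubsets n)

  Σs-0 : ∀ {n} {f : Subset n → ℚ} → (∀ S → f S ≡ 0ℚ) → Σs f ≡ 0ℚ
  Σs-0 {n} = sum-0 (allSubsets n)

  Σs-+ : ∀ {n} (f g : Subset n → ℚ) → Σs (λ S → f S + g S) ≡ Σs f + Σs g
  Σs-+ {n} = sum-+ (allSubsets n)

  Σs-* : ∀ {n} c (f : Subset n → ℚ) → Σs (λ S → c * f S) ≡ c * Σs f
  Σs-* {n} = sum-* (allSubsets n)

  Σs-0≤ : ∀ {n} {f : Subset n → ℚ} → (∀ S → 0ℚ ≤ f S) → 0ℚ ≤ Σs f
  Σs-0≤ {n} = sum-0≤ (allSubsets n)

  Σs-mono : ∀ {n} {f g : Subset n → ℚ} → (∀ S → f S ≤ g S) → Σs f ≤ Σs g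
  Σs-mono {n} = sum-mono (allSubsets n)

  Σs-false : ∀ {n} (f : Subset (suc n) → ℚ) → (∀ S → f (true ∷ S) ≡ 0ℚ) → Σs f ≡ Σs (λ S → f (false ∷ S))
  Σs-false f e = trans (Σs-suc f) (trans (cong (Σs (λ S → f (false ∷ S)) +_) (Σs-0 e)) (+-identityʳ _))

  _≡ᵇ_ : ∀ {n} → Subset n → Subset n → Bool
  [] ≡ᵇ [] = true
  (true ∷ S) ≡ᵇ (true ∷ T) = S ≡ᵇ T
  (false ∷ S) ≡ᵇ (false ∷ T) = S ≡ᵇ T
  (true ∷ S) ≡ᵇ (false ∷ T) = false
  (false ∷ S) ≡ᵇ (true ∷ T) = false

  _⊆ᵇ_ : ∀ {n} → Subset n → Subset n → Bool
  [] ⊆ᵇ [] = true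
  (true ∷ S) ⊆ᵇ (false ∷ T) = false
  (_ ∷ S) ⊆ᵇ (_ ∷ T) = S ⊆ᵇ T

  disjointᵇ : ∀ {n} → Subset n → Subset n → Bool
  disjointᵇ [] [] = true
  disjointᵇ (true ∷ S) (true ∷ T) = false
  disjointᵇ (_ ∷ S) (_ ∷ T) = disjointᵇ S T

  _∪_ : ∀ {n} → Subset n → Subset n → Subset n
  [] ∪ [] = []
  (x ∷ S) ∪ (y ∷ T) = (x ∨ y) ∷ (S ∪ T)

  card : ∀ {n} → Subset n → ℕ
  card [] = 0
  card (true ∷ S) = suc (card S)
  card (false ∷ S) = card S

  ∅ : ∀ {n} → Subset n
  ∅ {zero} = []
  ∅ {suc n} = false ∷ ∅

  ⁅_⁆ : ∀ {n} → Fin n → Subset n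
  ⁅ zero ⁆ = true ∷ ∅
  ⁅ suc v ⁆ = false ∷ ⁅ v ⁆

  ≡ᵇ-sound : ∀ {n} {S T : Subset n} → S ≡ᵇ T ≡ true → S ≡ T
  ≡ᵇ-sound {S = []} {[]} e = refl
  ≡ᵇ-sound {S = true ∷ S} {true ∷ T} e = cong (true ∷_) (≡ᵇ-sound e)
  ≡ᵇ-sound {S = false ∷ S} {false ∷ T} e = cong (false ∷_) (≡ᵇ-sound e)

  ≡ᵇ-refl : ∀ {n} (S : Subset n) → S ≡ᵇ S ≡ true
  ≡ᵇ-refl [] = refl
  ≡ᵇ-refl (true ∷ S) = ≡ᵇ-refl S
  ≡ᵇ-refl (false ∷ S) = ≡ᵇ-refl S

  ≡ᵇ-sym : ∀ {n} (S T : Subset n) → S ≡ᵇ T ≡ T ≡ᵇ S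
  ≡ᵇ-sym [] [] = refl
  ≡ᵇ-sym (true ∷ S) (true ∷ T) = ≡ᵇ-sym S T
  ≡ᵇ-sym (false ∷ S) (false ∷ T) = ≡ᵇ-sym S T
  ≡ᵇ-sym (true ∷ S) (false ∷ T) = refl
  ≡ᵇ-sym (false ∷ S) (true ∷ T) = refl

  ⊆ᵇ-sound : ∀ {n} {S T : Subset n} → S ⊆ᵇ T ≡ true → ∀ u → lookup S u ≡ true → lookup T u ≡ true
  ⊆ᵇ-sound {S = true ∷ S} {true ∷ T} e zero p = refl
  ⊆ᵇ-sound {S = true ∷ S} {true ∷ T} e (suc u) p = ⊆ᵇ-sound {S = S} {T} e u p
  ⊆ᵇ-sound {S = false ∷ S} {true ∷ T} e (suc u) p = ⊆ᵇ-sound {S = S} {T} e u p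
  ⊆ᵇ-sound {S = false ∷ S} {false ∷ T} e (suc u) p = ⊆ᵇ-sound {S = S} {T} e u p

  ⊆ᵇ-complete : ∀ {n} {S T : Subset n} → (∀ u → lookup S u ≡ true → lookup T u ≡ true) → S ⊆ᵇ T ≡ true
  ⊆ᵇ-complete {S = []} {[]} p = refl
  ⊆ᵇ-complete {S = true ∷ S} {true ∷ T} p = ⊆ᵇ-complete {S = S} {T} (λ u → p (suc u))
  ⊆ᵇ-complete {S = false ∷ S} {true ∷ T} p = ⊆ᵇ-complete {S = S} {T} (λ u → p (suc u))
  ⊆ᵇ-complete {S = false ∷ S} {false ∷ T} p = ⊆ᵇ-complete {S = S} {T} (λ u → p (suc u))
  ⊆ᵇ-complete {S = true ∷ S} {false ∷ T} p with p zero refl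
  ... | ()

  disjointᵇ-sound : ∀ {n} {S T : Subset n} → disjointᵇ S T ≡ true → ∀ u → lookup S u ≡ true → lookup T u ≡ false
  disjointᵇ-sound {S = true ∷ S} {false ∷ T} e zero p = refl
  disjointᵇ-sound {S = true ∷ S} {false ∷ T} e (suc u) p = disjointᵇ-sound {S = S} {T} e u p
  disjointᵇ-sound {S = false ∷ S} {true ∷ T} e (suc u) p = disjointᵇ-sound {S = S} {T} e u p
  disjointᵇ-sound {S = false ∷ S} {false ∷ T} e (suc u) p = disjointᵇ-sound {S = S} {T} e u p

  disjointᵇ-complete : ∀ {n} {S T : Subset n} → (∀ u → lookup S u ≡ true → lookup T u ≡ false) → disjointᵇ S T ≡ true
  disjointᵇ-complete {S = []} {[]} p = refl
  disjointᵇ-complete {S = true ∷ S} {false ∷ T} p = disjointᵇ-complete {S = S} {T} (λ u → p (suc u))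
  disjointᵇ-complete {S = false ∷ S} {true ∷ T} p = disjointᵇ-complete {S = S} {T} (λ u → p (suc u))
  disjointᵇ-complete {S = false ∷ S} {false ∷ T} p = disjointᵇ-complete {S = S} {T} (λ u → p (suc u))
  disjointᵇ-complete {S = true ∷ S} {true ∷ T} p with p zero refl
  ... | ()

  subset-ext : ∀ {n} {S T : Subset n} → (∀ u → lookup S u ≡ lookup T u) → S ≡ T
  subset-ext {S = S} {T} p = trans (sym (tabulate∘lookup S)) (trans (tabulate-cong p) (tabulate∘lookup T))

  lookup-∪ : ∀ {n} (S T : Subset n) u → lookup (S ∪ T) u ≡ lookup S u ∨ lookup T u
  lookup-∪ (x ∷ S) (y ∷ T) zero = refl
  lookup-∪ (x ∷ S) (y ∷ T) (suc u) = lookup-∪ S T u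

  ∈∪ˡ : ∀ {n} (S T : Subset n) u → lookup S u ≡ true → lookup (S ∪ T) u ≡ true
  ∈∪ˡ S T u e rewrite lookup-∪ S T u | e = refl

  ∈∪ʳ : ∀ {n} (S T : Subset n) u → lookup T u ≡ true → lookup (S ∪ T) u ≡ true
  ∈∪ʳ S T u e rewrite lookup-∪ S T u | e with lookup S u
  ... | true = refl
  ... | false = refl

  ∈∪-cases : ∀ {n} (S T : Subset n) u → lookup (S ∪ T) u ≡ true → (lookup S u ≡ true) ⊎ (lookup T u ≡ true)
  ∈∪-cases S T u e rewrite lookup-∪ S T u with lookup S u | lookup T u
  ... | true | _ = inj₁ refl
  ... | false | true = inj₂ refl

  ∉∅ : ∀ {n} (u : Fin n) → lookup (∅ {n}) u ≡ false
  ∉∅ zero = refl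
  ∉∅ (suc u) = ∉∅ u

  ∈⁅⁆ : ∀ {n} (v : Fin n) → lookup ⁅ v ⁆ v ≡ true
  ∈⁅⁆ zero = refl
  ∈⁅⁆ (suc v) = ∈⁅⁆ v

  ∈⁅⁆⇒≡ : ∀ {n} (v u : Fin n) → lookup ⁅ v ⁆ u ≡ true → u ≡ v
  ∈⁅⁆⇒≡ zero zero e = refl
  ∈⁅⁆⇒≡ zero (suc u) e = ⊥-elim (t≢f (trans (sym e) (∉∅ u)))
  ∈⁅⁆⇒≡ (suc v) (suc u) e = cong suc (∈⁅⁆⇒≡ v u e)

  card-∪ : ∀ {n} {S T : Subset n} → disjointᵇ S T ≡ true → card (S ∪ T) ≡ card S ℕ.+ card T
  card-∪ {S = []} {[]} e = refl
  card-∪ {S = true ∷ S} {false ∷ T} e = cong suc (card-∪ {S = S} {T} e)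
  card-∪ {S = false ∷ S} {true ∷ T} e = trans (cong suc (card-∪ {S = S} {T} e)) (sym (ℕP.+-suc (card S) (card T)))
  card-∪ {S = false ∷ S} {false ∷ T} e = card-∪ {S = S} {T} e

  card-∅ : ∀ n → card (∅ {n}) ≡ 0
  card-∅ zero = refl
  card-∅ (suc n) = card-∅ n

  card-⁅⁆ : ∀ {n} (v : Fin n) → card ⁅ v ⁆ ≡ 1
  card-⁅⁆ {suc n} zero = cong suc (card-∅ n)
  card-⁅⁆ (suc v) = card-⁅⁆ v

  card-≤ : ∀ {n} (S : Subset n) → card S ℕ.≤ n
  card-≤ [] = z≤n
  card-≤ (true ∷ S) = s≤s (card-≤ S)
  card-≤ (false ∷ S) = ℕP.m≤n⇒m≤1+n (card-≤ S)

  card-mono : ∀ {n} (S T : Subset n) → S ⊆ᵇ T ≡ true → card S ℕ.≤ card T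
  card-mono [] [] e = z≤n
  card-mono (true ∷ S) (true ∷ T) e = s≤s (card-mono S T e)
  card-mono (false ∷ S) (true ∷ T) e = ℕP.m≤n⇒m≤1+n (card-mono S T e)
  card-mono (false ∷ S) (false ∷ T) e = card-mono S T e

  -- Removing at least one element strictly decreases the cardinality; this is
  -- the termination measure of the greedy covering.
  card-strict : ∀ {n} (S T : Subset n) (v : Fin n) →
    S ⊆ᵇ T ≡ true → lookup T v ≡ true → lookup S v ≡ false → suc (card S) ℕ.≤ card T
  card-strict (false ∷ S) (true ∷ T) zero st tv sv = s≤s (card-mono S T st)
  card-strict (true ∷ S) (true ∷ T) (suc v) st tv sv = s≤s (card-strict S T v st tv sv)
  card-strict (false ∷ S) (true ∷ T) (suc v) st tv sv = ℕP.m≤n⇒m≤1+n (card-strict S T v st tv sv)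
  card-strict (false ∷ S) (false ∷ T) (suc v) st tv sv = card-strict S T v st tv sv

  card-pos : ∀ {n} (S : Subset n) (v : Fin n) → lookup S v ≡ true → 1 ℕ.≤ card S
  card-pos (true ∷ S) zero e = s≤s z≤n
  card-pos (true ∷ S) (suc v) e = s≤s z≤n
  card-pos (false ∷ S) (suc v) e = card-pos S v e

  Σv-suc : ∀ {n} (f : Fin (suc n) → ℚ) → Σv f ≡ f zero + Σv (λ u → f (suc u))
  Σv-suc {n} f = cong (λ xs → f zero + sumℚ xs)
    (trans (map-tabulate suc f) (sym (map-tabulate (λ u → u) (λ u → f (suc u)))))

  Σv-card : ∀ {n} (K : Subset n) → Σv (λ u → if lookup K u then 1ℚ else 0ℚ) ≡ ℕ→ℚ (card K)
  Σv-card [] = refl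
  Σv-card (x ∷ K) = trans (Σv-suc (λ u → if lookup (x ∷ K) u then 1ℚ else 0ℚ))
                          (trans (cong ((if x then 1ℚ else 0ℚ) +_) (Σv-card K)) (head x))
    where
    head : ∀ x → (if x then 1ℚ else 0ℚ) + ℕ→ℚ (card K) ≡ ℕ→ℚ (card (x ∷ K))
    head true = refl
    head false = +-identityˡ _

  Σs-point : ∀ {n} (T : Subset n) (f : Subset n → ℚ) → Σs (λ M → if M ≡ᵇ T then f M else 0ℚ) ≡ f T
  Σs-point [] f = +-identityʳ (f [])
  Σs-point {suc n} (true ∷ T) f = begin
    Σs (λ M → if M ≡ᵇ (true ∷ T) then f M else 0ℚ)
      ≡⟨ Σs-suc (λ M → if M ≡ᵇ (true ∷ T) then f M else 0ℚ) ⟩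
    Σs {n} (λ _ → 0ℚ) + Σs (λ M → if M ≡ᵇ T then f (true ∷ M) else 0ℚ)
      ≡⟨ cong₂ _+_ (Σs-0 {n} (λ _ → refl)) (Σs-point T (λ M → f (true ∷ M))) ⟩
    0ℚ + f (true ∷ T)
      ≡⟨ +-identityˡ _ ⟩
    f (true ∷ T) ∎
    where open ≡-Reasoning
  Σs-point {suc n} (false ∷ T) f = begin
    Σs (λ M → if M ≡ᵇ (false ∷ T) then f M else 0ℚ)
      ≡⟨ Σs-suc (λ M → if M ≡ᵇ (false ∷ T) then f M else 0ℚ) ⟩
    Σs (λ M → if M ≡ᵇ T then f (false ∷ M) else 0ℚ) + Σs {n} (λ _ → 0ℚ)
      ≡⟨ cong₂ _+_ (Σs-point T (λ M → f (false ∷ M))) (Σs-0 {n} (λ _ → refl)) ⟩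
    f (false ∷ T) + 0ℚ
      ≡⟨ +-identityʳ _ ⟩
    f (false ∷ T) ∎
    where open ≡-Reasoning

  Σs-term : ∀ {n} (f : Subset n → ℚ) (T : Subset n) → (∀ I → 0ℚ ≤ f I) → f T ≤ Σs f
  Σs-term f T f≥0 = ≤-trans (≤-reflexive (sym (Σs-point T f))) (Σs-mono drop-others)
    where
    drop-others : ∀ I → (if I ≡ᵇ T then f I else 0ℚ) ≤ f I
    drop-others I with I ≡ᵇ T
    ... | true = ≤-refl
    ... | false = f≥0 I

  -- Decomposition along a set A: every subset is uniquely J ∪ K with J
  -- disjoint from A and K ⊆ A, so  Σ_S g S = Σ_{J ∩ A = ∅} Σ_{K ⊆ A} g (J ∪ K).
  Σs-decompose : ∀ {n} (A : Subset n) (g : Subset n → ℚ) →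
    Σs g ≡ Σs (λ J → if disjointᵇ J A then Σs (λ K → if K ⊆ᵇ A then g (J ∪ K) else 0ℚ) else 0ℚ)
  Σs-decompose [] g = sym (+-identityʳ _)
  Σs-decompose (false ∷ A) g = begin
    Σs g
      ≡⟨ Σs-suc g ⟩
    Σs (λ S → g (false ∷ S)) + Σs (λ S → g (true ∷ S))
      ≡⟨ cong₂ _+_ (Σs-decompose A (λ S → g (false ∷ S))) (Σs-decompose A (λ S → g (true ∷ S))) ⟩
    Σs (λ J → outer A (λ K → g (false ∷ (J ∪ K))) J) + Σs (λ J → outer A (λ K → g (true ∷ (J ∪ K))) J)
      ≡⟨ cong₂ _+_ (Σs-cong (λ J → cong-outer J (inner false J))) (Σs-cong (λ J → cong-outer J (inner true J))) ⟩
    Σs (λ J → outer (false ∷ A) (λ K → g ((false ∷ J) ∪ K)) (false ∷ J))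
      + Σs (λ J → outer (false ∷ A) (λ K → g ((true ∷ J) ∪ K)) (true ∷ J))
      ≡⟨ sym (Σs-suc (λ J → outer (false ∷ A) (λ K → g (J ∪ K)) J)) ⟩
    Σs (λ J → outer (false ∷ A) (λ K → g (J ∪ K)) J) ∎
    where
    open ≡-Reasoning
    outer : ∀ {m} (A : Subset m) → (Subset m → ℚ) → Subset m → ℚ
    outer A h J = if disjointᵇ J A then Σs (λ K → if K ⊆ᵇ A then h K else 0ℚ) else 0ℚ
    cong-outer : ∀ J {x y} → x ≡ y → (if disjointᵇ J A then x else 0ℚ) ≡ (if disjointᵇ J A then y else 0ℚ)
    cong-outer J e = cong (if disjointᵇ J A then_else 0ℚ) e
    inner : ∀ b J → Σs (λ K → if K ⊆ᵇ A then g (b ∷ (J ∪ K)) else 0ℚ)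
                  ≡ Σs (λ K → if K ⊆ᵇ (false ∷ A) then g ((b ∷ J) ∪ K) else 0ℚ)
    inner false J = sym (Σs-false (λ K → if K ⊆ᵇ (false ∷ A) then g ((false ∷ J) ∪ K) else 0ℚ) (λ _ → refl))
    inner true J = sym (Σs-false (λ K → if K ⊆ᵇ (false ∷ A) then g ((true ∷ J) ∪ K) else 0ℚ) (λ _ → refl))
  Σs-decompose {suc n} (true ∷ A) g = begin
    Σs g
      ≡⟨ Σs-suc g ⟩
    Σs (λ S → g (false ∷ S)) + Σs (λ S → g (true ∷ S))
      ≡⟨ cong₂ _+_ (Σs-decompose A (λ S → g (false ∷ S))) (Σs-decompose A (λ S → g (true ∷ S))) ⟩
    Σs (λ J → outer (λ K → g (false ∷ (J ∪ K))) J) + Σs (λ J → outer (λ K → g (true ∷ (J ∪ K))) J)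
      ≡⟨ sym (Σs-+ {n} _ _) ⟩
    Σs (λ J → outer (λ K → g (false ∷ (J ∪ K))) J + outer (λ K → g (true ∷ (J ∪ K))) J)
      ≡⟨ Σs-cong merge ⟩
    Σs (λ J → if disjointᵇ (false ∷ J) (true ∷ A)
              then Σs (λ K → if K ⊆ᵇ (true ∷ A) then g ((false ∷ J) ∪ K) else 0ℚ) else 0ℚ)
      ≡⟨ sym (Σs-false (λ J → if disjointᵇ J (true ∷ A)
                              then Σs (λ K → if K ⊆ᵇ (true ∷ A) then g (J ∪ K) else 0ℚ) else 0ℚ) (λ _ → refl)) ⟩
    Σs (λ J → if disjointᵇ J (true ∷ A) then Σs (λ K → if K ⊆ᵇ (true ∷ A) then g (J ∪ K) else 0ℚ) else 0ℚ) ∎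
    where
    open ≡-Reasoning
    outer : (Subset n → ℚ) → Subset n → ℚ
    outer h J = if disjointᵇ J A then Σs (λ K → if K ⊆ᵇ A then h K else 0ℚ) else 0ℚ
    merge : ∀ J → outer (λ K → g (false ∷ (J ∪ K))) J + outer (λ K → g (true ∷ (J ∪ K))) J
                ≡ (if disjointᵇ J A then Σs (λ K → if K ⊆ᵇ (true ∷ A) then g ((false ∷ J) ∪ K) else 0ℚ) else 0ℚ)
    merge J with disjointᵇ J A
    ... | true = sym (Σs-suc (λ K → if K ⊆ᵇ (true ∷ A) then g ((false ∷ J) ∪ K) else 0ℚ))
    ... | false = +-identityˡ 0ℚ

  module Binomial (t : ℚ) where

    weight : ∀ {n} → Subset n → ℚ
    weight S = t ^ℚ card S

    weight-∪ : ∀ {n} (J K : Subset n) → disjointᵇ J K ≡ true → weight (J ∪ K) ≡ weight J * weight K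
    weight-∪ J K d = trans (cong (t ^ℚ_) (card-∪ {S = J} {K} d)) (^ℚ-+ t (card J) (card K))

    Z₀ : ∀ {n} → Subset n → ℚ
    Z₀ Y = Σs (λ K → if K ⊆ᵇ Y then weight K else 0ℚ)

    Z₁ : ∀ {n} → Subset n → ℚ
    Z₁ Y = Σs (λ K → if K ⊆ᵇ Y then ℕ→ℚ (card K) * weight K else 0ℚ)

    Z₀-binomial : ∀ {n} (Y : Subset n) → Z₀ Y ≡ (1ℚ + t) ^ℚ card Y
    Z₀-binomial [] = +-identityʳ 1ℚ
    Z₀-binomial (false ∷ Y) = trans (Σs-false (λ K → if K ⊆ᵇ (false ∷ Y) then weight K else 0ℚ) (λ _ → refl)) (Z₀-binomial Y)
    Z₀-binomial (true ∷ Y) = begin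
      Z₀ (true ∷ Y)
        ≡⟨ Σs-suc (λ K → if K ⊆ᵇ (true ∷ Y) then weight K else 0ℚ) ⟩
      Z₀ Y + Σs (λ K → if K ⊆ᵇ Y then t * weight K else 0ℚ)
        ≡⟨ cong (Z₀ Y +_) (trans (Σs-cong (λ K → if-* (K ⊆ᵇ Y) t (weight K)))
                                 (Σs-* t (λ K → if K ⊆ᵇ Y then weight K else 0ℚ))) ⟩
      Z₀ Y + t * Z₀ Y
        ≡⟨ solve 2 (λ s t → s :+ t :* s := (con 1ℚ :+ t) :* s) refl (Z₀ Y) t ⟩
      (1ℚ + t) * Z₀ Y
        ≡⟨ cong ((1ℚ + t) *_) (Z₀-binomial Y) ⟩
      (1ℚ + t) ^ℚ card (true ∷ Y) ∎
      where open ≡-Reasoning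

    Z₁-binomial : ∀ {n} (Y : Subset n) → (1ℚ + t) * Z₁ Y ≡ ℕ→ℚ (card Y) * t * ((1ℚ + t) ^ℚ card Y)
    Z₁-binomial [] = solve 1 (λ t → (con 1ℚ :+ t) :* (con 0ℚ :* con 1ℚ :+ con 0ℚ) := con 0ℚ :* t :* con 1ℚ) refl t
    Z₁-binomial (false ∷ Y) =
      trans (cong ((1ℚ + t) *_) (Σs-false (λ K → if K ⊆ᵇ (false ∷ Y) then ℕ→ℚ (card K) * weight K else 0ℚ) (λ _ → refl)))
            (Z₁-binomial Y)
    Z₁-binomial (true ∷ Y) = begin
      (1ℚ + t) * Z₁ (true ∷ Y)
        ≡⟨ cong ((1ℚ + t) *_) (Σs-suc (λ K → if K ⊆ᵇ (true ∷ Y) then ℕ→ℚ (card K) * weight K else 0ℚ)) ⟩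
      (1ℚ + t) * (Z₁ Y + Σs (λ K → if K ⊆ᵇ Y then (1ℚ + ℕ→ℚ (card K)) * (t * weight K) else 0ℚ))
        ≡⟨ cong (λ z → (1ℚ + t) * (Z₁ Y + z)) with-head ⟩
      (1ℚ + t) * (Z₁ Y + (t * Z₀ Y + t * Z₁ Y))
        ≡⟨ solve 3 (λ t a b → (con 1ℚ :+ t) :* (a :+ (t :* b :+ t :* a))
                            := (con 1ℚ :+ t) :* ((con 1ℚ :+ t) :* a) :+ t :* ((con 1ℚ :+ t) :* b)) refl t (Z₁ Y) (Z₀ Y) ⟩
      (1ℚ + t) * ((1ℚ + t) * Z₁ Y) + t * ((1ℚ + t) * Z₀ Y)
        ≡⟨ cong₂ (λ a b → (1ℚ + t) * a + t * ((1ℚ + t) * b)) (Z₁-binomial Y) (Z₀-binomial Y) ⟩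
      (1ℚ + t) * (ℕ→ℚ (card Y) * t * P) + t * ((1ℚ + t) * P)
        ≡⟨ solve 3 (λ t y p → (con 1ℚ :+ t) :* (y :* t :* p) :+ t :* ((con 1ℚ :+ t) :* p)
                            := (con 1ℚ :+ y) :* t :* ((con 1ℚ :+ t) :* p)) refl t (ℕ→ℚ (card Y)) P ⟩
      ℕ→ℚ (card (true ∷ Y)) * t * ((1ℚ + t) ^ℚ card (true ∷ Y)) ∎
      where
      open ≡-Reasoning
      P : ℚ
      P = (1ℚ + t) ^ℚ card Y
      f₀ f₁ : Subset _ → ℚ
      f₀ K = if K ⊆ᵇ Y then weight K else 0ℚ
      f₁ K = if K ⊆ᵇ Y then ℕ→ℚ (card K) * weight K else 0ℚ
      -- the sets containing the new element contribute (1 + |K|) t t^|K|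
      split-count : ∀ K → (if K ⊆ᵇ Y then (1ℚ + ℕ→ℚ (card K)) * (t * weight K) else 0ℚ) ≡ t * f₀ K + t * f₁ K
      split-count K with K ⊆ᵇ Y
      ... | true = solve 3 (λ c t w → (con 1ℚ :+ c) :* (t :* w) := t :* w :+ t :* (c :* w)) refl (ℕ→ℚ (card K)) t (weight K)
      ... | false = solve 1 (λ t → con 0ℚ := t :* con 0ℚ :+ t :* con 0ℚ) refl t
      with-head : Σs (λ K → if K ⊆ᵇ Y then (1ℚ + ℕ→ℚ (card K)) * (t * weight K) else 0ℚ) ≡ t * Z₀ Y + t * Z₁ Y
      with-head = trans (Σs-cong split-count)
        (trans (Σs-+ (λ K → t * f₀ K) (λ K → t * f₁ K)) (cong₂ _+_ (Σs-* t f₀) (Σs-* t f₁)))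

  -- For y = 0 it is Bernoulli's inequality; the inductive step in k and y
  -- together multiplies both sides by 1 + l.

  module OccupancyInequality (l : ℚ) (l≥0 : 0ℚ ≤ l) where

    private
      P : ℕ → ℚ
      P m = (1ℚ + l) ^ℚ m

      1+l≥0 : 0ℚ ≤ 1ℚ + l
      1+l≥0 = 0≤+ 0≤1 l≥0

    bernoulli : ∀ k → 1ℚ + ℕ→ℚ k * l ≤ P k
    bernoulli zero = ≤-reflexive (solve 1 (λ l → con 1ℚ :+ con 0ℚ :* l := con 1ℚ) refl l)
    bernoulli (suc k) = begin
      1ℚ + (1ℚ + ℕ→ℚ k) * l
        ≤⟨ 0≤-⇒≤ (≤-trans (0≤* (ℕ→ℚ-0≤ k) (0≤* l≥0 l≥0)) (≤-reflexive
             (solve 2 (λ k l → k :* (l :* l) := (con 1ℚ :+ l) :* (con 1ℚ :+ k :* l) :- (con 1ℚ :+ (con 1ℚ :+ k) :* l))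
                    refl (ℕ→ℚ k) l))) ⟩
      (1ℚ + l) * (1ℚ + ℕ→ℚ k * l)
        ≤⟨ *-monoˡ-≤-0≤ 1+l≥0 (bernoulli k) ⟩
      (1ℚ + l) * P k ∎
      where open ≤-Reasoning

    -- the case k = 0:  (1+l)^y ≤ 1 + y l (1+l)^y
    power-bound : ∀ y → P y ≤ 1ℚ + ℕ→ℚ y * l * P y
    power-bound zero = ≤-reflexive (solve 1 (λ l → con 1ℚ := con 1ℚ :+ con 0ℚ :* l :* con 1ℚ) refl l)
    power-bound (suc y) = begin
      P (suc y)
        ≡⟨ solve 2 (λ l p → (con 1ℚ :+ l) :* p := p :+ l :* p) refl l (P y) ⟩
      P y + l * P y
        ≤⟨ +-monoˡ-≤ (l * P y) (power-bound y) ⟩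
      1ℚ + ℕ→ℚ y * l * P y + l * P y
        ≤⟨ 0≤-⇒≤ (≤-trans (0≤* (0≤+ 0≤1 (ℕ→ℚ-0≤ y)) (0≤* (0≤* l≥0 l≥0) (^ℚ-0≤ 1+l≥0 y))) (≤-reflexive
             (solve 3 (λ y l p → (con 1ℚ :+ y) :* ((l :* l) :* p)
                               := (con 1ℚ :+ (con 1ℚ :+ y) :* l :* ((con 1ℚ :+ l) :* p)) :- (con 1ℚ :+ y :* l :* p :+ l :* p))
                    refl (ℕ→ℚ y) l (P y)))) ⟩
      1ℚ + ℕ→ℚ (suc y) * l * P (suc y) ∎
      where open ≤-Reasoning

    occupancy-inequality : ∀ k y → (1ℚ + ℕ→ℚ k * l) * P y ≤ P k + ℕ→ℚ y * l * P y
    occupancy-inequality k zero = begin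
      (1ℚ + ℕ→ℚ k * l) * 1ℚ ≡⟨ *-identityʳ _ ⟩
      1ℚ + ℕ→ℚ k * l        ≤⟨ bernoulli k ⟩
      P k                   ≡⟨ solve 2 (λ p l → p := p :+ con 0ℚ :* l :* con 1ℚ) refl (P k) l ⟩
      P k + 0ℚ * l * 1ℚ     ∎
      where open ≤-Reasoning
    occupancy-inequality zero (suc y) =
      ≤-trans (≤-reflexive (solve 2 (λ l p → (con 1ℚ :+ con 0ℚ :* l) :* p := p) refl l (P (suc y)))) (power-bound (suc y))
    occupancy-inequality (suc k) (suc y) = begin
      (1ℚ + ℕ→ℚ (suc k) * l) * P (suc y)
        ≡⟨ solve 3 (λ k l p → (con 1ℚ :+ (con 1ℚ :+ k) :* l) :* ((con 1ℚ :+ l) :* p)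
                            := (con 1ℚ :+ l) :* ((con 1ℚ :+ k :* l) :* p) :+ (con 1ℚ :+ l) :* (l :* p)) refl (ℕ→ℚ k) l (P y) ⟩
      (1ℚ + l) * ((1ℚ + ℕ→ℚ k * l) * P y) + (1ℚ + l) * (l * P y)
        ≤⟨ +-monoˡ-≤ ((1ℚ + l) * (l * P y)) (*-monoˡ-≤-0≤ 1+l≥0 (occupancy-inequality k y)) ⟩
      (1ℚ + l) * (P k + ℕ→ℚ y * l * P y) + (1ℚ + l) * (l * P y)
        ≡⟨ solve 4 (λ y l p q → (con 1ℚ :+ l) :* (q :+ y :* l :* p) :+ (con 1ℚ :+ l) :* (l :* p)
                              := (con 1ℚ :+ l) :* q :+ (con 1ℚ :+ y) :* l :* ((con 1ℚ :+ l) :* p)) refl (ℕ→ℚ y) l (P y) (P k) ⟩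
      P (suc k) + ℕ→ℚ (suc y) * l * P (suc y) ∎
      where open ≤-Reasoning

  allᵇ : ∀ {n} → (Fin n → Bool) → Bool
  allᵇ {zero} f = true
  allᵇ {suc n} f = f zero ∧ allᵇ (λ u → f (suc u))

  anyᵇ : ∀ {n} → (Fin n → Bool) → Bool
  anyᵇ {zero} f = false
  anyᵇ {suc n} f = f zero ∨ anyᵇ (λ u → f (suc u))

  allᵇ-sound : ∀ {n} (f : Fin n → Bool) → allᵇ f ≡ true → ∀ u → f u ≡ true
  allᵇ-sound f e zero with f zero
  ... | true = refl
  allᵇ-sound f e (suc u) with f zero
  ... | true = allᵇ-sound (λ u → f (suc u)) e u

  allᵇ-complete : ∀ {n} (f : Fin n → Bool) → (∀ u → f u ≡ true) → allᵇ f ≡ true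
  allᵇ-complete {zero} f e = refl
  allᵇ-complete {suc n} f e rewrite e zero = allᵇ-complete (λ u → f (suc u)) (λ u → e (suc u))

  anyᵇ-sound : ∀ {n} (f : Fin n → Bool) → anyᵇ f ≡ true → Σ (Fin n) (λ u → f u ≡ true)
  anyᵇ-sound {suc n} f e with f zero in eq
  ... | true = zero , eq
  ... | false with anyᵇ-sound (λ u → f (suc u)) e
  ...   | u , p = suc u , p

  anyᵇ-complete : ∀ {n} (f : Fin n → Bool) u → f u ≡ true → anyᵇ f ≡ true
  anyᵇ-complete f zero e rewrite e = refl
  anyᵇ-complete f (suc u) e with f zero
  ... | true = refl
  ... | false = anyᵇ-complete (λ u → f (suc u)) u e

  ∧-true : ∀ {a b : Bool} → a ∧ b ≡ true → (a ≡ true) × (b ≡ true)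
  ∧-true {true} {true} e = refl , refl

  ∧-intro : ∀ {a b : Bool} → a ≡ true → b ≡ true → a ∧ b ≡ true
  ∧-intro refl refl = refl

  module GraphBasics {n} (G : Graph n) where

    independentᵇ : Subset n → Bool
    independentᵇ I = allᵇ (λ u → allᵇ (λ x → not (lookup I u ∧ lookup I x ∧ adj G u x)))

    independentᵇ-sound : ∀ I → independentᵇ I ≡ true →
      ∀ u x → lookup I u ≡ true → lookup I x ≡ true → adj G u x ≡ false
    independentᵇ-sound I e u x p q with allᵇ-sound _ (allᵇ-sound _ e u) x
    ... | r rewrite p | q with adj G u x
    ...   | false = refl

    independentᵇ-complete : ∀ I → (∀ u x → lookup I u ≡ true → lookup I x ≡ true → adj G u x ≡ false) →
      independentᵇ I ≡ true
    independentᵇ-complete I h = allᵇ-complete _ (λ u → allᵇ-complete _ (λ x → no-edge u x))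
      where
      no-edge : ∀ u x → not (lookup I u ∧ lookup I x ∧ adj G u x) ≡ true
      no-edge u x with lookup I u in p | lookup I x in q
      ... | false | _ = refl
      ... | true | false = refl
      ... | true | true rewrite h u x p q = refl

    no-loop : ∀ u → adj G u u ≢ true
    no-loop u e = t≢f (trans (sym e) (Graph.irrefl G u))

    N[_] : Fin n → Subset n
    N[ v ] = tabulate (λ x → adj G v x ∨ ⌊ x Fin.≟ v ⌋)

    ∈N[v] : ∀ v → lookup N[ v ] v ≡ true
    ∈N[v] v rewrite lookup∘tabulate (λ x → adj G v x ∨ ⌊ x Fin.≟ v ⌋) v with v Fin.≟ v | adj G v v
    ... | yes _ | true = refl
    ... | yes _ | false = refl
    ... | no v≢v | _ = ⊥-elim (v≢v refl)

    adj⇒∈N[v] : ∀ v x → adj G v x ≡ true → lookup N[ v ] x ≡ true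
    adj⇒∈N[v] v x e rewrite lookup∘tabulate (λ x → adj G v x ∨ ⌊ x Fin.≟ v ⌋) x | e = refl

    ∈N[v]-cases : ∀ v x → lookup N[ v ] x ≡ true → (adj G v x ≡ true) ⊎ (x ≡ v)
    ∈N[v]-cases v x e rewrite lookup∘tabulate (λ x → adj G v x ∨ ⌊ x Fin.≟ v ⌋) x with adj G v x | x Fin.≟ v
    ... | true | _ = inj₁ refl
    ... | false | yes p = inj₂ p

    Σnb : Fin n → (Fin n → ℚ) → ℚ
    Σnb v f = Σv (λ u → if adj G v u then f u else 0ℚ)

    Σnb-cong : ∀ v {f g : Fin n → ℚ} → (∀ u → f u ≡ g u) → Σnb v f ≡ Σnb v g
    Σnb-cong v e = sum-cong (allFin n) (λ u → cong (if adj G v u then_else 0ℚ) (e u))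

    Σnb-+ : ∀ v f g → Σnb v (λ u → f u + g u) ≡ Σnb v f + Σnb v g
    Σnb-+ v f g = trans (sum-cong (allFin n) (λ u → if-+ (adj G v u) (f u) (g u))) (sum-+ (allFin n) _ _)

    Σnb-* : ∀ v c f → Σnb v (λ u → c * f u) ≡ c * Σnb v f
    Σnb-* v c f = trans (sum-cong (allFin n) (λ u → if-* (adj G v u) c (f u))) (sum-* (allFin n) c _)

    Σnb-mono : ∀ v {f g} → (∀ u → f u ≤ g u) → Σnb v f ≤ Σnb v g
    Σnb-mono v {f} {g} le = sum-mono (allFin n) guarded
      where
      guarded : ∀ u → (if adj G v u then f u else 0ℚ) ≤ (if adj G v u then g u else 0ℚ)
      guarded u with adj G v u
      ... | true = le u
      ... | false = ≤-refl

    Σnb-1≤Δ : ∀ v → Σnb v (λ _ → 1ℚ) ≤ ℕ→ℚ (maxDegree G)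
    Σnb-1≤Δ v = begin
      Σnb v (λ _ → 1ℚ)     ≡⟨ sym degree-as-sum ⟩
      ℕ→ℚ (degree G v)    ≤⟨ ℕ→ℚ-mono (≤-max (allFin n) (∈-allFin v)) ⟩
      ℕ→ℚ (maxDegree G)   ∎
      where
      open ≤-Reasoning
      ℕ→ℚ-sum : ∀ {A : Set} (xs : List A) (f : A → ℕ) → ℕ→ℚ (sumℕ (map f xs)) ≡ sumℚ (map (λ a → ℕ→ℚ (f a)) xs)
      ℕ→ℚ-sum [] f = refl
      ℕ→ℚ-sum (x ∷ xs) f = trans (ℕ→ℚ-+ (f x) _) (cong (ℕ→ℚ (f x) +_) (ℕ→ℚ-sum xs f))
      indicator : ∀ u → ℕ→ℚ (if adj G v u then 1 else 0) ≡ (if adj G v u then 1ℚ else 0ℚ)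
      indicator u with adj G v u
      ... | true = +-identityʳ 1ℚ
      ... | false = refl
      degree-as-sum : ℕ→ℚ (degree G v) ≡ Σnb v (λ _ → 1ℚ)
      degree-as-sum = trans (ℕ→ℚ-sum (allFin n) (λ u → if adj G v u then 1 else 0)) (sum-cong (allFin n) indicator)
      ≤-max : ∀ (xs : List (Fin n)) {x} → x ∈ xs → degree G x ℕ.≤ foldr ℕ._⊔_ 0 (map (degree G) xs)
      ≤-max (y ∷ xs) (here refl) = ℕP.m≤m⊔n (degree G y) _
      ≤-max (y ∷ xs) (there m) = ℕP.m≤n⇒m≤o⊔n (degree G y) (≤-max xs m)

  -- The hard-core model at fugacity t on the subgraph induced by H ⊆ V:
  -- independent I ⊆ H gets weight t^|I|; Z H is the partition function and
  -- occ H u = Σ_{I ∋ u} t^|I| the (unnormalised) occupancy of u.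

  module HardCoreModel {n} (G : Graph n) (t : ℚ) where
    open GraphBasics G
    open Binomial t

    admissibleᵇ : Subset n → Subset n → Bool
    admissibleᵇ H I = I ⊆ᵇ H ∧ independentᵇ I

    hc : Subset n → Subset n → ℚ
    hc H I = if admissibleᵇ H I then weight I else 0ℚ

    Z : Subset n → ℚ
    Z H = Σs (hc H)

    occ : Subset n → Fin n → ℚ
    occ H u = Σs (λ I → if lookup I u then hc H I else 0ℚ)

    nb : Fin n → Subset n → ℚ
    nb v I = Σnb v (λ u → if lookup I u then 1ℚ else 0ℚ)

    admissible-∪ˡ : ∀ H J K → admissibleᵇ H (J ∪ K) ≡ true → admissibleᵇ H J ≡ true
    admissible-∪ˡ H J K e with ∧-true {(J ∪ K) ⊆ᵇ H} e
    ... | sub , ind = ∧-intro (⊆ᵇ-complete {S = J} {H} (λ u p → ⊆ᵇ-sound {S = J ∪ K} {H} sub u (∈∪ˡ J K u p)))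
                              (independentᵇ-complete J (λ u x p q →
                                 independentᵇ-sound (J ∪ K) ind u x (∈∪ˡ J K u p) (∈∪ˡ J K x q)))

    module _ (t≥0 : 0ℚ ≤ t) where

      weight-0≤ : ∀ {m} (S : Subset m) → 0ℚ ≤ weight S
      weight-0≤ S = ^ℚ-0≤ t≥0 (card S)

      hc-0≤ : ∀ H I → 0ℚ ≤ hc H I
      hc-0≤ H I with admissibleᵇ H I
      ... | true = weight-0≤ I
      ... | false = ≤-refl

      occ-0≤ : ∀ H u → 0ℚ ≤ occ H u
      occ-0≤ H u = Σs-0≤ (λ I → 0≤if (lookup I u) (hc-0≤ H I))

    -- Every vertex of H is occupied with positive weight (already {u} counts).
    occ-pos : 0ℚ < t → ∀ H u → lookup H u ≡ true → 0ℚ < occ H u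
    occ-pos t>0 H u hu = <-≤-trans t>0 (begin
      t                ≡⟨ sym (*-identityʳ t) ⟩
      t * 1ℚ           ≡⟨ sym singleton-term ⟩
      term ⁅ u ⁆       ≤⟨ Σs-term term ⁅ u ⁆ (λ I → 0≤if (lookup I u) (hc-0≤ (<⇒≤ t>0) H I)) ⟩
      occ H u          ∎)
      where
      open ≤-Reasoning
      term : Subset n → ℚ
      term I = if lookup I u then hc H I else 0ℚ
      singleton-admissible : admissibleᵇ H ⁅ u ⁆ ≡ true
      singleton-admissible = ∧-intro
        (⊆ᵇ-complete {S = ⁅ u ⁆} {H} (λ x e → subst (λ z → lookup H z ≡ true) (sym (∈⁅⁆⇒≡ u x e)) hu))
        (independentᵇ-complete ⁅ u ⁆ no-edge)
        where
        no-edge : ∀ x y → lookup ⁅ u ⁆ x ≡ true → lookup ⁅ u ⁆ y ≡ true → adj G x y ≡ false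
        no-edge x y p q with ∈⁅⁆⇒≡ u x p | ∈⁅⁆⇒≡ u y q
        ... | refl | refl = Graph.irrefl G u
      singleton-term : term ⁅ u ⁆ ≡ t * 1ℚ
      singleton-term rewrite ∈⁅⁆ u | singleton-admissible | card-⁅⁆ u = refl

    occ-zero : ∀ H u → lookup H u ≡ false → occ H u ≡ 0ℚ
    occ-zero H u hu = Σs-0 vanish
      where
      vanish : ∀ I → (if lookup I u then hc H I else 0ℚ) ≡ 0ℚ
      vanish I with lookup I u in iu
      ... | false = refl
      ... | true with admissibleᵇ H I in g
      ...   | false = refl
      ...   | true = ⊥-elim (t≢f (trans (sym (⊆ᵇ-sound {S = I} {H} (proj₁ (∧-true {I ⊆ᵇ H} g)) u iu)) hu))

    Σs-hc-nb : ∀ H v → Σs (λ I → hc H I * nb v I) ≡ Σnb v (occ H)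
    Σs-hc-nb H v = begin
      Σs (λ I → hc H I * nb v I)     ≡⟨ Σs-cong expand ⟩
      Σs (λ I → Σv (g I))            ≡⟨ sum-swap (allSubsets n) (allFin n) g ⟩
      Σv (λ u → Σs (λ I → g I u))    ≡⟨ sum-cong (allFin n) collapse ⟩
      Σnb v (occ H)                  ∎
      where
      open ≡-Reasoning
      g : Subset n → Fin n → ℚ
      g I u = if adj G v u then (if lookup I u then hc H I else 0ℚ) else 0ℚ
      expand : ∀ I → hc H I * nb v I ≡ Σv (g I)
      expand I = trans (sym (sum-* (allFin n) (hc H I) _)) (sum-cong (allFin n) term)
        where
        term : ∀ u → hc H I * (if adj G v u then (if lookup I u then 1ℚ else 0ℚ) else 0ℚ) ≡ g I u
        term u with adj G v u | lookup I u
        ... | true | true = *-identityʳ (hc H I)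
        ... | true | false = *-zeroʳ (hc H I)
        ... | false | _ = *-zeroʳ (hc H I)
      collapse : ∀ u → Σs (λ I → g I u) ≡ (if adj G v u then occ H u else 0ℚ)
      collapse u with adj G v u
      ... | true = refl
      ... | false = Σs-0 {n} (λ _ → refl)

  -- With
  --   D = t(1+kt),  a = D + (1+t)^k,  b = t(1+t),
  -- every v ∈ H satisfies  D · Z H ≤ a · occ H v + b · Σ_{u ∼ v} occ H u
  -- in a triangle-free graph.  Equivalently Σ_I F H v I ≥ 0, where
  --   F H v I = t^|I| (a [v ∈ I] + b |N(v) ∩ I| - D)   (I admissible in H).

  module LocalOccupancy {n} (G : Graph n) (tf : TriangleFree G) (t : ℚ) (k : ℕ) where
    open GraphBasics G
    open Binomial t
    open HardCoreModel G t

    D a b : ℚ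
    D = t * (1ℚ + ℕ→ℚ k * t)
    a = D + (1ℚ + t) ^ℚ k
    b = t * (1ℚ + t)

    F : Subset n → Fin n → Subset n → ℚ
    F H v I = if admissibleᵇ H I then weight I * (a * (if lookup I v then 1ℚ else 0ℚ) + b * nb v I - D) else 0ℚ

    Σs-F : ∀ H v → Σs (F H v) ≡ a * occ H v + b * Σnb v (occ H) - D * Z H
    Σs-F H v = begin
      Σs (F H v)
        ≡⟨ Σs-cong F-linear ⟩
      Σs (λ I → (a * occ-term I + b * (hc H I * nb v I)) - D * hc H I)
        ≡⟨ sum-- (allSubsets n) (λ I → a * occ-term I + b * (hc H I * nb v I)) (λ I → D * hc H I) ⟩
      Σs (λ I → a * occ-term I + b * (hc H I * nb v I)) - Σs (λ I → D * hc H I)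
        ≡⟨ cong₂ _-_ (Σs-+ (λ I → a * occ-term I) (λ I → b * (hc H I * nb v I))) (Σs-* D (hc H)) ⟩
      Σs (λ I → a * occ-term I) + Σs (λ I → b * (hc H I * nb v I)) - D * Z H
        ≡⟨ cong₂ (λ x y → x + y - D * Z H) (Σs-* a occ-term)
                 (trans (Σs-* b (λ I → hc H I * nb v I)) (cong (b *_) (Σs-hc-nb H v))) ⟩
      a * occ H v + b * Σnb v (occ H) - D * Z H ∎
      where
      open ≡-Reasoning
      occ-term : Subset n → ℚ
      occ-term I = if lookup I v then hc H I else 0ℚ
      F-linear : ∀ I → F H v I ≡ a * occ-term I + b * (hc H I * nb v I) - D * hc H I
      F-linear I with admissibleᵇ H I | lookup I v
      ... | true | true = solve 5 (λ w a b x d → w :* (a :* con 1ℚ :+ b :* x :- d) := a :* w :+ b :* (w :* x) :- d :* w)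
                            refl (weight I) a b (nb v I) D
      ... | true | false = solve 5 (λ w a b x d → w :* (a :* con 0ℚ :+ b :* x :- d) := a :* con 0ℚ :+ b :* (w :* x) :- d :* w)
                            refl (weight I) a b (nb v I) D
      ... | false | true = solve 4 (λ a b x d → con 0ℚ := a :* con 0ℚ :+ b :* (con 0ℚ :* x) :- d :* con 0ℚ) refl a b (nb v I) D
      ... | false | false = solve 4 (λ a b x d → con 0ℚ := a :* con 0ℚ :+ b :* (con 0ℚ :* x) :- d :* con 0ℚ) refl a b (nb v I) D

    -- Fix H and v ∈ H, and split I = J ∪ K with J ∩ N[v] = ∅ and K ⊆ N[v].
    module AtVertex (H : Subset n) (v : Fin n) (v∈H : lookup H v ≡ true) where

      free : Subset n → Fin n → Bool
      free J u = adj G v u ∧ (lookup H u ∧ not (anyᵇ (λ x → lookup J x ∧ adj G u x)))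

      Y : Subset n → Subset n
      Y J = tabulate (free J)

      Y-sound : ∀ J u → lookup (Y J) u ≡ true →
        (adj G v u ≡ true) × (lookup H u ≡ true) × (∀ x → lookup J x ≡ true → adj G u x ≡ false)
      Y-sound J u e rewrite lookup∘tabulate (free J) u with ∧-true {adj G v u} e
      ... | vu , e′ with ∧-true {lookup H u} e′
      ...   | hu , e″ = vu , hu , no-nb
        where
        no-nb : ∀ x → lookup J x ≡ true → adj G u x ≡ false
        no-nb x jx with adj G u x in ux
        ... | false = refl
        ... | true with anyᵇ (λ x → lookup J x ∧ adj G u x) in an
        ...   | false = ⊥-elim (t≢f (trans (sym (anyᵇ-complete (λ x → lookup J x ∧ adj G u x) x (∧-intro jx ux))) an))

      Y-complete : ∀ J u → adj G v u ≡ true → lookup H u ≡ true → (∀ x → lookup J x ≡ true → adj G u x ≡ false) →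
        lookup (Y J) u ≡ true
      Y-complete J u vu hu no-nb rewrite lookup∘tabulate (free J) u | vu | hu
        with anyᵇ (λ x → lookup J x ∧ adj G u x) in an
      ... | false = refl
      ... | true with anyᵇ-sound (λ x → lookup J x ∧ adj G u x) an
      ...   | x , q with ∧-true {lookup J x} q
      ...     | jx , ux = ⊥-elim (t≢f (trans (sym ux) (no-nb x jx)))

      v∉Y : ∀ J → lookup (Y J) v ≡ false
      v∉Y J with lookup (Y J) v in e
      ... | false = refl
      ... | true = ⊥-elim (no-loop v (proj₁ (Y-sound J v e)))

      Y⊆N[v] : ∀ J K → K ⊆ᵇ Y J ≡ true → K ⊆ᵇ N[ v ] ≡ true
      Y⊆N[v] J K e = ⊆ᵇ-complete {S = K} {N[ v ]}
        (λ u ku → adj⇒∈N[v] v u (proj₁ (Y-sound J u (⊆ᵇ-sound {S = K} {Y J} e u ku))))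

      -- The value of F on the fibre over an admissible J: only K = {v} and the
      -- independent-and-free sets K ⊆ Y J contribute.
      fibre-value : Subset n → Subset n → ℚ
      fibre-value J K = weight J * ((if K ≡ᵇ ⁅ v ⁆ then t * (a - D) else 0ℚ)
                                   + (if K ⊆ᵇ Y J then weight K * (b * ℕ→ℚ (card K) - D) else 0ℚ))

      module Fibre (J : Subset n) (J#N[v] : disjointᵇ J N[ v ] ≡ true) (J-adm : admissibleᵇ H J ≡ true) where

        J∉N[v] : ∀ u → lookup J u ≡ true → lookup N[ v ] u ≡ false
        J∉N[v] = disjointᵇ-sound {S = J} {N[ v ]} J#N[v]

        v∉J : lookup J v ≡ false
        v∉J with lookup J v in e
        ... | false = refl
        ... | true = ⊥-elim (t≢f (trans (sym (∈N[v] v)) (J∉N[v] v e)))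

        nb∉J : ∀ u → adj G v u ≡ true → lookup J u ≡ false
        nb∉J u vu with lookup J u in e
        ... | false = refl
        ... | true = ⊥-elim (t≢f (trans (sym (adj⇒∈N[v] v u vu)) (J∉N[v] u e)))

        J⊆H : ∀ u → lookup J u ≡ true → lookup H u ≡ true
        J⊆H = ⊆ᵇ-sound {S = J} {H} (proj₁ (∧-true {J ⊆ᵇ H} J-adm))

        J-independent : independentᵇ J ≡ true
        J-independent = proj₂ (∧-true {J ⊆ᵇ H} J-adm)

        J#K : ∀ K → K ⊆ᵇ N[ v ] ≡ true → disjointᵇ J K ≡ true
        J#K K sk = disjointᵇ-complete {S = J} {K} J∉K
          where
          J∉K : ∀ u → lookup J u ≡ true → lookup K u ≡ false
          J∉K u ju with lookup K u in ku
          ... | false = refl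
          ... | true = ⊥-elim (t≢f (trans (sym (⊆ᵇ-sound {S = K} {N[ v ]} sk u ku)) (J∉N[v] u ju)))

        -- J has no neighbour of v, so only K counts towards |N(v) ∩ I|.
        nb-J∪K : ∀ K → nb v (J ∪ K) ≡ nb v K
        nb-J∪K K = sum-cong (allFin n) same
          where
          same : ∀ u → (if adj G v u then (if lookup (J ∪ K) u then 1ℚ else 0ℚ) else 0ℚ)
                     ≡ (if adj G v u then (if lookup K u then 1ℚ else 0ℚ) else 0ℚ)
          same u with adj G v u in vu
          ... | false = refl
          ... | true rewrite lookup-∪ J K u | nb∉J u vu = refl

        nb-K : ∀ K → K ⊆ᵇ N[ v ] ≡ true → lookup K v ≡ false → nb v K ≡ ℕ→ℚ (card K)
        nb-K K sk kv = trans (sum-cong (allFin n) all-adjacent) (Σv-card K)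
          where
          all-adjacent : ∀ u → (if adj G v u then (if lookup K u then 1ℚ else 0ℚ) else 0ℚ) ≡ (if lookup K u then 1ℚ else 0ℚ)
          all-adjacent u with adj G v u in vu
          ... | true = refl
          ... | false with lookup K u in ku
          ...   | false = refl
          ...   | true with ∈N[v]-cases v u (⊆ᵇ-sound {S = K} {N[ v ]} sk u ku)
          ...     | inj₁ vu′ = ⊥-elim (t≢f (trans (sym vu′) vu))
          ...     | inj₂ refl = ⊥-elim (t≢f (trans (sym ku) kv))

        nb-⁅v⁆ : nb v ⁅ v ⁆ ≡ 0ℚ
        nb-⁅v⁆ = sum-0 (allFin n) vanish
          where
          vanish : ∀ u → (if adj G v u then (if lookup ⁅ v ⁆ u then 1ℚ else 0ℚ) else 0ℚ) ≡ 0ℚ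
          vanish u with adj G v u in vu
          ... | false = refl
          ... | true with lookup ⁅ v ⁆ u in su
          ...   | false = refl
          ...   | true with ∈⁅⁆⇒≡ v u su
          ...     | refl = ⊥-elim (no-loop v vu)

        ⁅v⁆⊆N[v] : ∀ u → lookup ⁅ v ⁆ u ≡ true → lookup N[ v ] u ≡ true
        ⁅v⁆⊆N[v] u e with ∈⁅⁆⇒≡ v u e
        ... | refl = ∈N[v] v

        J∪⁅v⁆-admissible : admissibleᵇ H (J ∪ ⁅ v ⁆) ≡ true
        J∪⁅v⁆-admissible = ∧-intro (⊆ᵇ-complete {S = J ∪ ⁅ v ⁆} {H} sub) (independentᵇ-complete (J ∪ ⁅ v ⁆) ind)
          where
          sub : ∀ u → lookup (J ∪ ⁅ v ⁆) u ≡ true → lookup H u ≡ true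
          sub u e with ∈∪-cases J ⁅ v ⁆ u e
          ... | inj₁ ju = J⊆H u ju
          ... | inj₂ su with ∈⁅⁆⇒≡ v u su
          ...   | refl = v∈H
          v-isolated : ∀ x → lookup (J ∪ ⁅ v ⁆) x ≡ true → adj G v x ≡ false
          v-isolated x e with adj G v x in vx
          ... | false = refl
          ... | true with ∈∪-cases J ⁅ v ⁆ x e
          ...   | inj₁ jx = ⊥-elim (t≢f (trans (sym jx) (nb∉J x vx)))
          ...   | inj₂ sx with ∈⁅⁆⇒≡ v x sx
          ...     | refl = ⊥-elim (no-loop v vx)
          ind : ∀ u x → lookup (J ∪ ⁅ v ⁆) u ≡ true → lookup (J ∪ ⁅ v ⁆) x ≡ true → adj G u x ≡ false
          ind u x p q with ∈∪-cases J ⁅ v ⁆ u p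
          ... | inj₂ su with ∈⁅⁆⇒≡ v u su
          ...   | refl = v-isolated x q
          ind u x p q | inj₁ ju with ∈∪-cases J ⁅ v ⁆ x q
          ...   | inj₁ jx = independentᵇ-sound J J-independent u x ju jx
          ...   | inj₂ sx with ∈⁅⁆⇒≡ v x sx
          ...     | refl = trans (Graph.sym G u v) (v-isolated u p)

        ⊈Y : ∀ K → lookup K v ≡ true → K ⊆ᵇ Y J ≡ false
        ⊈Y K kv with K ⊆ᵇ Y J in e
        ... | false = refl
        ... | true = ⊥-elim (t≢f (trans (sym (⊆ᵇ-sound {S = K} {Y J} e v kv)) (v∉Y J)))

        ≢⁅v⁆ : ∀ K → lookup K v ≡ false → K ≡ᵇ ⁅ v ⁆ ≡ false
        ≢⁅v⁆ K kv with K ≡ᵇ ⁅ v ⁆ in e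
        ... | false = refl
        ... | true with ≡ᵇ-sound {S = K} e
        ...   | refl = ⊥-elim (t≢f (trans (sym (∈⁅⁆ v)) kv))

        fibre-⁅v⁆ : F H v (J ∪ ⁅ v ⁆) ≡ fibre-value J ⁅ v ⁆
        fibre-⁅v⁆ rewrite J∪⁅v⁆-admissible | ≡ᵇ-refl ⁅ v ⁆ | ⊈Y ⁅ v ⁆ (∈⁅⁆ v)
                        | ∈∪ʳ J ⁅ v ⁆ v (∈⁅⁆ v) | nb-J∪K ⁅ v ⁆ | nb-⁅v⁆
                        | weight-∪ J ⁅ v ⁆ (J#K ⁅ v ⁆ (⊆ᵇ-complete {S = ⁅ v ⁆} {N[ v ]} ⁅v⁆⊆N[v])) | card-⁅⁆ v
          = solve 5 (λ w t a b d → w :* (t :* con 1ℚ) :* (a :* con 1ℚ :+ b :* con 0ℚ :- d) := w :* (t :* (a :- d) :+ con 0ℚ))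
              refl (weight J) t a b D

        -- v ∈ K ≠ {v}: K contains an edge at v, so J ∪ K is not independent.
        fibre-v-and-more : ∀ K → K ⊆ᵇ N[ v ] ≡ true → lookup K v ≡ true → K ≡ᵇ ⁅ v ⁆ ≡ false →
          F H v (J ∪ K) ≡ fibre-value J K
        fibre-v-and-more K sk kv ek rewrite ek | ⊈Y K kv with admissibleᵇ H (J ∪ K) in eg
        ... | false = solve 1 (λ w → con 0ℚ := w :* (con 0ℚ :+ con 0ℚ)) refl (weight J)
        ... | true = ⊥-elim (t≢f (trans (sym (≡ᵇ-refl K)) (trans (cong (K ≡ᵇ_) (subset-ext K≡⁅v⁆)) ek)))
          where
          ind : independentᵇ (J ∪ K) ≡ true
          ind = proj₂ (∧-true {(J ∪ K) ⊆ᵇ H} eg)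
          K≡⁅v⁆ : ∀ u → lookup K u ≡ lookup ⁅ v ⁆ u
          K≡⁅v⁆ u with lookup K u in ku | lookup ⁅ v ⁆ u in su
          ... | true | true = refl
          ... | false | false = refl
          ... | false | true with ∈⁅⁆⇒≡ v u su
          ...   | refl = ⊥-elim (t≢f (trans (sym kv) ku))
          K≡⁅v⁆ u | true | false with ∈N[v]-cases v u (⊆ᵇ-sound {S = K} {N[ v ]} sk u ku)
          ...   | inj₂ refl = ⊥-elim (t≢f (trans (sym (∈⁅⁆ v)) su))
          ...   | inj₁ vu = ⊥-elim (t≢f (trans (sym vu)
                               (independentᵇ-sound (J ∪ K) ind v u (∈∪ʳ J K v kv) (∈∪ʳ J K u ku))))

        -- v ∉ K: J ∪ K is admissible iff K ⊆ Y J; here triangle-freeness makes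
        -- the free neighbours of v pairwise non-adjacent.
        fibre-without-v : ∀ K → K ⊆ᵇ N[ v ] ≡ true → lookup K v ≡ false → F H v (J ∪ K) ≡ fibre-value J K
        fibre-without-v K sk kv rewrite ≢⁅v⁆ K kv with admissibleᵇ H (J ∪ K) in eg | K ⊆ᵇ Y J in ey
        ... | false | false = solve 1 (λ w → con 0ℚ := w :* (con 0ℚ :+ con 0ℚ)) refl (weight J)
        ... | true | true rewrite lookup-∪ J K v | v∉J | kv | nb-J∪K K | nb-K K sk kv | weight-∪ J K (J#K K sk)
          = solve 6 (λ w x a b c d → w :* x :* (a :* con 0ℚ :+ b :* c :- d) := w :* (con 0ℚ :+ x :* (b :* c :- d)))
              refl (weight J) (weight K) a b (ℕ→ℚ (card K)) D
        ... | true | false = ⊥-elim (t≢f (trans (sym (⊆ᵇ-complete {S = K} {Y J} K⊆Y)) ey))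
          where
          J∪K⊆H : (J ∪ K) ⊆ᵇ H ≡ true
          J∪K⊆H = proj₁ (∧-true {(J ∪ K) ⊆ᵇ H} eg)
          ind : independentᵇ (J ∪ K) ≡ true
          ind = proj₂ (∧-true {(J ∪ K) ⊆ᵇ H} eg)
          K⊆Y : ∀ u → lookup K u ≡ true → lookup (Y J) u ≡ true
          K⊆Y u ku = Y-complete J u vu (⊆ᵇ-sound {S = J ∪ K} {H} J∪K⊆H u (∈∪ʳ J K u ku))
                       (λ x jx → independentᵇ-sound (J ∪ K) ind u x (∈∪ʳ J K u ku) (∈∪ˡ J K x jx))
            where
            vu : adj G v u ≡ true
            vu with ∈N[v]-cases v u (⊆ᵇ-sound {S = K} {N[ v ]} sk u ku)
            ... | inj₁ e = e
            ... | inj₂ refl = ⊥-elim (t≢f (trans (sym ku) kv))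
        ... | false | true = ⊥-elim (t≢f (trans (sym J∪K-admissible) eg))
          where
          K⊆Y : ∀ u → lookup K u ≡ true → lookup (Y J) u ≡ true
          K⊆Y = ⊆ᵇ-sound {S = K} {Y J} ey
          sub : ∀ u → lookup (J ∪ K) u ≡ true → lookup H u ≡ true
          sub u e with ∈∪-cases J K u e
          ... | inj₁ ju = J⊆H u ju
          ... | inj₂ ku = proj₁ (proj₂ (Y-sound J u (K⊆Y u ku)))
          ind : ∀ u x → lookup (J ∪ K) u ≡ true → lookup (J ∪ K) x ≡ true → adj G u x ≡ false
          ind u x p q with ∈∪-cases J K u p | ∈∪-cases J K x q
          ... | inj₁ ju | inj₁ jx = independentᵇ-sound J J-independent u x ju jx
          ... | inj₂ ku | inj₁ jx = proj₂ (proj₂ (Y-sound J u (K⊆Y u ku))) x jx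
          ... | inj₁ ju | inj₂ kx = trans (Graph.sym G u x) (proj₂ (proj₂ (Y-sound J x (K⊆Y x kx))) u ju)
          ... | inj₂ ku | inj₂ kx with adj G u x in ux
          ...   | false = refl
          ...   | true = ⊥-elim (tf v u x (proj₁ (Y-sound J u (K⊆Y u ku))) ux (proj₁ (Y-sound J x (K⊆Y x kx))))
          J∪K-admissible : admissibleᵇ H (J ∪ K) ≡ true
          J∪K-admissible = ∧-intro (⊆ᵇ-complete {S = J ∪ K} {H} sub) (independentᵇ-complete (J ∪ K) ind)

        fibre : ∀ K → K ⊆ᵇ N[ v ] ≡ true → F H v (J ∪ K) ≡ fibre-value J K
        fibre K sk = by-v (lookup K v) refl
          where
          by-⁅v⁆ : ∀ e → lookup K v ≡ true → K ≡ᵇ ⁅ v ⁆ ≡ e → F H v (J ∪ K) ≡ fibre-value J K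
          by-⁅v⁆ false kv ek = fibre-v-and-more K sk kv ek
          by-⁅v⁆ true kv ek = subst (λ K → F H v (J ∪ K) ≡ fibre-value J K) (sym (≡ᵇ-sound {S = K} ek)) fibre-⁅v⁆
          by-v : ∀ e → lookup K v ≡ e → F H v (J ∪ K) ≡ fibre-value J K
          by-v false kv = fibre-without-v K sk kv
          by-v true kv = by-⁅v⁆ (K ≡ᵇ ⁅ v ⁆) kv refl

        Σ-fibre : Σs (λ K → if K ⊆ᵇ N[ v ] then F H v (J ∪ K) else 0ℚ)
                ≡ weight J * (t * (a - D) + (b * Z₁ (Y J) - D * Z₀ (Y J)))
        Σ-fibre = begin
          Σs (λ K → if K ⊆ᵇ N[ v ] then F H v (J ∪ K) else 0ℚ)
            ≡⟨ Σs-cong (λ K → guarded K) ⟩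
          Σs (λ K → weight J * (single K + free-part K))
            ≡⟨ Σs-* (weight J) (λ K → single K + free-part K) ⟩
          weight J * Σs (λ K → single K + free-part K)
            ≡⟨ cong (weight J *_) (trans (Σs-+ single free-part) (cong₂ _+_ Σ-single Σ-free-part)) ⟩
          weight J * (t * (a - D) + (b * Z₁ (Y J) - D * Z₀ (Y J))) ∎
          where
          open ≡-Reasoning
          single free-part : Subset n → ℚ
          single K = if K ⊆ᵇ N[ v ] then (if K ≡ᵇ ⁅ v ⁆ then t * (a - D) else 0ℚ) else 0ℚ
          free-part K = if K ⊆ᵇ N[ v ] then (if K ⊆ᵇ Y J then weight K * (b * ℕ→ℚ (card K) - D) else 0ℚ) else 0ℚ
          guarded : ∀ K → (if K ⊆ᵇ N[ v ] then F H v (J ∪ K) else 0ℚ) ≡ weight J * (single K + free-part K)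
          guarded K with K ⊆ᵇ N[ v ] in sk
          ... | true = fibre K sk
          ... | false = sym (trans (cong (weight J *_) (+-identityʳ 0ℚ)) (*-zeroʳ (weight J)))
          Σ-single : Σs single ≡ t * (a - D)
          Σ-single = begin
            Σs single
              ≡⟨ Σs-cong (λ K → if-swap (K ⊆ᵇ N[ v ]) (K ≡ᵇ ⁅ v ⁆) (t * (a - D))) ⟩
            Σs (λ K → if K ≡ᵇ ⁅ v ⁆ then (if K ⊆ᵇ N[ v ] then t * (a - D) else 0ℚ) else 0ℚ)
              ≡⟨ Σs-point ⁅ v ⁆ (λ K → if K ⊆ᵇ N[ v ] then t * (a - D) else 0ℚ) ⟩
            (if ⁅ v ⁆ ⊆ᵇ N[ v ] then t * (a - D) else 0ℚ)
              ≡⟨ cong (if_then t * (a - D) else 0ℚ) (⊆ᵇ-complete {S = ⁅ v ⁆} {N[ v ]} ⁅v⁆⊆N[v]) ⟩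
            t * (a - D) ∎
          split-free : ∀ K → free-part K ≡ b * (if K ⊆ᵇ Y J then ℕ→ℚ (card K) * weight K else 0ℚ)
                                         - D * (if K ⊆ᵇ Y J then weight K else 0ℚ)
          split-free K with K ⊆ᵇ Y J in ey
          ... | true rewrite Y⊆N[v] J K ey =
            solve 4 (λ w b c d → w :* (b :* c :- d) := b :* (c :* w) :- d :* w) refl (weight K) b (ℕ→ℚ (card K)) D
          ... | false = trans (if-0 (K ⊆ᵇ N[ v ])) (solve 2 (λ b d → con 0ℚ := b :* con 0ℚ :- d :* con 0ℚ) refl b D)
          Σ-free-part : Σs free-part ≡ b * Z₁ (Y J) - D * Z₀ (Y J)
          Σ-free-part = trans (Σs-cong split-free) (trans (sum-- (allSubsets n) _ _)
            (cong₂ _-_ (Σs-* b (λ K → if K ⊆ᵇ Y J then ℕ→ℚ (card K) * weight K else 0ℚ))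
                       (Σs-* D (λ K → if K ⊆ᵇ Y J then weight K else 0ℚ))))

      -- Fibres over non-admissible J vanish: admissibility of J ∪ K forces that of J.
      Σ-fibre-inadmissible : ∀ J → admissibleᵇ H J ≡ false →
        Σs (λ K → if K ⊆ᵇ N[ v ] then F H v (J ∪ K) else 0ℚ) ≡ 0ℚ
      Σ-fibre-inadmissible J J-inadm = Σs-0 vanish
        where
        vanish : ∀ K → (if K ⊆ᵇ N[ v ] then F H v (J ∪ K) else 0ℚ) ≡ 0ℚ
        vanish K with K ⊆ᵇ N[ v ]
        ... | false = refl
        ... | true with admissibleᵇ H (J ∪ K) in eg
        ...   | false = refl
        ...   | true = ⊥-elim (t≢f (trans (sym (admissible-∪ˡ H J K eg)) J-inadm))

    -- The fibre bracket is nonnegative for every Y; with y = |Y| it equals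
    -- t ((1+t)^k + y t (1+t)^y - (1+kt)(1+t)^y) by the binomial identities.
    fibre-bracket-0≤ : 0ℚ ≤ t → ∀ (Y : Subset n) → 0ℚ ≤ t * (a - D) + (b * Z₁ Y - D * Z₀ Y)
    fibre-bracket-0≤ t≥0 Y = ≤-trans (0≤* t≥0 (≤⇒0≤- (occupancy-inequality k y))) (≤-reflexive (sym as-inequality))
      where
      open OccupancyInequality t t≥0 using (occupancy-inequality)
      y = card Y
      Py = (1ℚ + t) ^ℚ y
      Pk = (1ℚ + t) ^ℚ k
      as-inequality : t * (a - D) + (b * Z₁ Y - D * Z₀ Y) ≡ t * ((Pk + ℕ→ℚ y * t * Py) - (1ℚ + ℕ→ℚ k * t) * Py)
      as-inequality = begin
        t * (a - D) + (b * Z₁ Y - D * Z₀ Y)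
          ≡⟨ solve 5 (λ t kk z₁ z₀ pk → t :* ((t :* (con 1ℚ :+ kk :* t) :+ pk) :- t :* (con 1ℚ :+ kk :* t))
                                        :+ (t :* (con 1ℚ :+ t) :* z₁ :- t :* (con 1ℚ :+ kk :* t) :* z₀)
                                      := t :* (pk :+ (con 1ℚ :+ t) :* z₁ :- (con 1ℚ :+ kk :* t) :* z₀))
               refl t (ℕ→ℚ k) (Z₁ Y) (Z₀ Y) Pk ⟩
        t * (Pk + (1ℚ + t) * Z₁ Y - (1ℚ + ℕ→ℚ k * t) * Z₀ Y)
          ≡⟨ cong₂ (λ x z → t * (Pk + x - (1ℚ + ℕ→ℚ k * t) * z)) (Z₁-binomial Y) (Z₀-binomial Y) ⟩
        t * ((Pk + ℕ→ℚ y * t * Py) - (1ℚ + ℕ→ℚ k * t) * Py) ∎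
        where open ≡-Reasoning

    Σs-F-0≤ : 0ℚ ≤ t → ∀ H v → lookup H v ≡ true → 0ℚ ≤ Σs (F H v)
    Σs-F-0≤ t≥0 H v v∈H = ≤-trans (Σs-0≤ fibre-0≤) (≤-reflexive (sym (Σs-decompose N[ v ] (F H v))))
      where
      open AtVertex H v v∈H
      fibre-0≤ : ∀ J → 0ℚ ≤ (if disjointᵇ J N[ v ] then Σs (λ K → if K ⊆ᵇ N[ v ] then F H v (J ∪ K) else 0ℚ) else 0ℚ)
      fibre-0≤ J with disjointᵇ J N[ v ] in J#N[v]
      ... | false = ≤-refl
      ... | true with admissibleᵇ H J in J-adm
      ...   | false = ≤-reflexive (sym (Σ-fibre-inadmissible J J-adm))
      ...   | true = ≤-trans (0≤* (weight-0≤ t≥0 J) (fibre-bracket-0≤ t≥0 (Y J)))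
                             (≤-reflexive (sym (Fibre.Σ-fibre J J#N[v] J-adm)))

    local-occupancy : 0ℚ ≤ t → ∀ H v → lookup H v ≡ true → D * Z H ≤ a * occ H v + b * Σnb v (occ H)
    local-occupancy t≥0 H v v∈H = 0≤-⇒≤ (≤-trans (Σs-F-0≤ t≥0 H v v∈H) (≤-reflexive (Σs-F H v)))

  argmin : ∀ {m} (p : Fin m → Bool) (f : Fin m → ℚ) →
    (∀ u → p u ≡ false) ⊎ Σ (Fin m) (λ j → (p j ≡ true) × (∀ u → p u ≡ true → f j ≤ f u))
  argmin {zero} p f = inj₁ (λ ())
  argmin {suc m} p f with argmin (λ u → p (suc u)) (λ u → f (suc u)) | p zero in p0
  ... | inj₁ none | false = inj₁ λ { zero → p0 ; (suc u) → none u }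
  ... | inj₁ none | true = inj₂ (zero , p0 , λ { zero _ → ≤-refl ; (suc u) e → ⊥-elim (t≢f (trans (sym e) (none u))) })
  ... | inj₂ (j , pj , min) | false = inj₂ (suc j , pj , λ { zero e → ⊥-elim (t≢f (trans (sym e) p0)) ; (suc u) e → min u e })
  ... | inj₂ (j , pj , min) | true with f zero ≤? f (suc j)
  ...   | yes le = inj₂ (zero , p0 , λ { zero _ → ≤-refl ; (suc u) e → ≤-trans le (min u e) })
  ...   | no nle = inj₂ (suc j , pj , λ { zero _ → <⇒≤ (≰⇒> nle) ; (suc u) e → min u e })

  -- The reciprocal, extended by 1/0 = 0 so that it is total.
  recip : ℚ → ℚ
  recip q with q ≟ 0ℚ
  ... | yes _ = 0ℚ
  ... | no q≢0 = 1/_ q {{≢-nonZero q≢0}}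

  recip-inverse : ∀ q → q ≢ 0ℚ → q * recip q ≡ 1ℚ
  recip-inverse q q≢0 with q ≟ 0ℚ
  ... | yes q≡0 = ⊥-elim (q≢0 q≡0)
  ... | no q≢0′ = *-inverseʳ q {{≢-nonZero q≢0′}}

  recip-0≤ : ∀ q → 0ℚ < q → 0ℚ ≤ recip q
  recip-0≤ q q>0 with q ≟ 0ℚ
  ... | yes _ = ≤-refl
  ... | no q≢0 = <⇒≤ (positive⁻¹ (1/_ q {{≢-nonZero q≢0}}) {{1/pos⇒pos q {{positive q>0}}}})

  -- A Cover of a demand d : V → ℚ≥0 consists of
  -- weights on independent sets covering every vertex u exactly d u times,
  -- whose total weight is either 0 or, by local occupancy, charged to a single
  -- vertex v:  D · Σ w ≤ a · d v + b · Σ_{u ∼ v} d u.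

  module GreedyCovering {n} (G : Graph n) (tf : TriangleFree G) (t : ℚ) (k : ℕ) (t>0 : 0ℚ < t) where
    open GraphBasics G
    open Binomial t
    open HardCoreModel G t
    open LocalOccupancy G tf t k

    t≥0 : 0ℚ ≤ t
    t≥0 = <⇒≤ t>0

    D-0≤ : 0ℚ ≤ D
    D-0≤ = 0≤* t≥0 (0≤+ 0≤1 (0≤* (ℕ→ℚ-0≤ k) t≥0))

    a-0≤ : 0ℚ ≤ a
    a-0≤ = 0≤+ D-0≤ (^ℚ-0≤ (0≤+ 0≤1 t≥0) k)

    b-0≤ : 0ℚ ≤ b
    b-0≤ = 0≤* t≥0 (0≤+ 0≤1 t≥0)

    supp : (Fin n → ℚ) → Subset n
    supp d = tabulate (λ u → ⌊ 0ℚ <? d u ⌋)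

    ∈supp : ∀ d u → 0ℚ < d u → lookup (supp d) u ≡ true
    ∈supp d u p rewrite lookup∘tabulate (λ u → ⌊ 0ℚ <? d u ⌋) u with 0ℚ <? d u
    ... | yes _ = refl
    ... | no ¬p = ⊥-elim (¬p p)

    supp-sound : ∀ d u → lookup (supp d) u ≡ true → 0ℚ < d u
    supp-sound d u e rewrite lookup∘tabulate (λ u → ⌊ 0ℚ <? d u ⌋) u with 0ℚ <? d u
    ... | yes p = p

    Charged : (Fin n → ℚ) → ℚ → Set
    Charged d W = Σ (Fin n) (λ v → (0ℚ < d v) × (D * W ≤ a * d v + b * Σnb v d))

    record Cover (d : Fin n → ℚ) : Set where
      field
        w         : Subset n → ℚ
        w-0≤      : ∀ I → 0ℚ ≤ w I
        exact     : ∀ u → Σs (λ I → if lookup I u then w I else 0ℚ) ≡ d u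
        on-indep  : ∀ I → independentᵇ I ≡ false → w I ≡ 0ℚ
        charged   : (Σs w ≡ 0ℚ) ⊎ Charged d (Σs w)

    zero-cover : ∀ d → (∀ u → 0ℚ ≤ d u) → (∀ u → lookup (supp d) u ≡ false) → Cover d
    zero-cover d d≥0 none = record
      { w = λ _ → 0ℚ ; w-0≤ = λ _ → ≤-refl ; exact = exact ; on-indep = λ _ _ → refl
      ; charged = inj₁ (Σs-0 {n} (λ _ → refl)) }
      where
      exact : ∀ u → Σs (λ I → if lookup I u then 0ℚ else 0ℚ) ≡ d u
      exact u = trans (Σs-0 (λ I → if-0 (lookup I u)))
                      (≤-antisym (d≥0 u) (≮⇒≥ (λ p → t≢f (trans (sym (∈supp d u p)) (none u)))))

    -- Let v₀ ∈ H = supp d minimise d u / occ H u over H and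
    -- c = d v₀ / occ H v₀.  Subtracting c times the hard-core measure on H
    -- leaves a demand d′ = d - c · occ H that is still nonnegative, vanishes at
    -- v₀ (so its support is strictly smaller), and any cover of d′ extends to
    -- one of d by adding c · hc H.
    module Peel (d : Fin n → ℚ) (d≥0 : ∀ u → 0ℚ ≤ d u) (v₀ : Fin n) (v₀∈H : lookup (supp d) v₀ ≡ true)
                (minimal : ∀ u → lookup (supp d) u ≡ true →
                           d v₀ * recip (occ (supp d) v₀) ≤ d u * recip (occ (supp d) u)) where
      H : Subset n
      H = supp d

      c : ℚ
      c = d v₀ * recip (occ H v₀)

      d′ : Fin n → ℚ
      d′ u = d u - c * occ H u

      c-0≤ : 0ℚ ≤ c
      c-0≤ = 0≤* (d≥0 v₀) (recip-0≤ _ (occ-pos t>0 H v₀ v₀∈H))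

      ratio-cancel : ∀ u → lookup H u ≡ true → d u * recip (occ H u) * occ H u ≡ d u
      ratio-cancel u hu = begin
        d u * recip (occ H u) * occ H u   ≡⟨ solve 3 (λ x r q → x :* r :* q := x :* (q :* r)) refl (d u) (recip (occ H u)) (occ H u) ⟩
        d u * (occ H u * recip (occ H u)) ≡⟨ cong (d u *_) (recip-inverse (occ H u) (λ e → <-irrefl (sym e) (occ-pos t>0 H u hu))) ⟩
        d u * 1ℚ                         ≡⟨ *-identityʳ (d u) ⟩
        d u                              ∎
        where open ≡-Reasoning

      c·occ≤d : ∀ u → c * occ H u ≤ d u
      c·occ≤d u with lookup H u in hu
      ... | true = ≤-trans (*-monoʳ-≤-0≤ (occ-0≤ t≥0 H u) (minimal u hu)) (≤-reflexive (ratio-cancel u hu))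
      ... | false = ≤-trans (≤-reflexive (trans (cong (c *_) (occ-zero H u hu)) (*-zeroʳ c))) (d≥0 u)

      d′-0≤ : ∀ u → 0ℚ ≤ d′ u
      d′-0≤ u = ≤⇒0≤- (c·occ≤d u)

      d′≤d : ∀ u → d′ u ≤ d u
      d′≤d u = 0≤-⇒≤ (≤-trans (0≤* c-0≤ (occ-0≤ t≥0 H u))
                              (≤-reflexive (solve 2 (λ x y → y := x :- (x :- y)) refl (d u) (c * occ H u))))

      d′+c·occ : ∀ u → c * occ H u + d′ u ≡ d u
      d′+c·occ u = solve 2 (λ x y → y :+ (x :- y) := x) refl (d u) (c * occ H u)

      support-shrinks : suc (card (supp d′)) ℕ.≤ card H
      support-shrinks = card-strict (supp d′) H v₀ sub v₀∈H v₀∉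
        where
        sub : supp d′ ⊆ᵇ H ≡ true
        sub = ⊆ᵇ-complete {S = supp d′} {H} (λ u e → ∈supp d u (<-≤-trans (supp-sound d′ u e) (d′≤d u)))
        v₀∉ : lookup (supp d′) v₀ ≡ false
        v₀∉ with lookup (supp d′) v₀ in e
        ... | false = refl
        ... | true = ⊥-elim (<-irrefl (sym d′v₀≡0) (supp-sound d′ v₀ e))
          where
          d′v₀≡0 : d′ v₀ ≡ 0ℚ
          d′v₀≡0 = trans (cong (λ z → d v₀ - z) (ratio-cancel v₀ v₀∈H)) (+-inverseʳ (d v₀))

      scaled-occupancy : ∀ v → lookup H v ≡ true → c * (D * Z H) ≤ a * (c * occ H v) + b * Σnb v (λ u → c * occ H u)
      scaled-occupancy v hv = ≤-trans (*-monoˡ-≤-0≤ c-0≤ (local-occupancy t≥0 H v hv)) (≤-reflexive (begin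
        c * (a * occ H v + b * Σnb v (occ H))
          ≡⟨ solve 5 (λ c a b q s → c :* (a :* q :+ b :* s) := a :* (c :* q) :+ b :* (c :* s)) refl c a b (occ H v) (Σnb v (occ H)) ⟩
        a * (c * occ H v) + b * (c * Σnb v (occ H))
          ≡⟨ cong (λ z → a * (c * occ H v) + b * z) (sym (Σnb-* v c (occ H))) ⟩
        a * (c * occ H v) + b * Σnb v (λ u → c * occ H u) ∎))
        where open ≡-Reasoning

      -- The new total weight c · Z(H) + W′ is charged to v₀ if W′ = 0, and
      -- otherwise to the vertex v carrying W′ (which lies in H as d v ≥ d′ v > 0).
      charge : ∀ W′ → (W′ ≡ 0ℚ) ⊎ Charged d′ W′ → Charged d (c * Z H + W′)
      charge W′ (inj₁ W′≡0) = v₀ , supp-sound d v₀ v₀∈H , (begin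
        D * (c * Z H + W′)                          ≡⟨ cong (λ z → D * (c * Z H + z)) W′≡0 ⟩
        D * (c * Z H + 0ℚ)                          ≡⟨ solve 3 (λ d c z → d :* (c :* z :+ con 0ℚ) := c :* (d :* z)) refl D c (Z H) ⟩
        c * (D * Z H)                               ≤⟨ scaled-occupancy v₀ v₀∈H ⟩
        a * (c * occ H v₀) + b * Σnb v₀ (λ u → c * occ H u)
          ≤⟨ +-mono-≤ (*-monoˡ-≤-0≤ a-0≤ (c·occ≤d v₀)) (*-monoˡ-≤-0≤ b-0≤ (Σnb-mono v₀ c·occ≤d)) ⟩
        a * d v₀ + b * Σnb v₀ d                     ∎)
        where open ≤-Reasoning
      charge W′ (inj₂ (v , d′v>0 , at-v)) = v , dv>0 , (begin
        D * (c * Z H + W′)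
          ≡⟨ solve 4 (λ d c z w → d :* (c :* z :+ w) := c :* (d :* z) :+ d :* w) refl D c (Z H) W′ ⟩
        c * (D * Z H) + D * W′                      ≤⟨ +-mono-≤ (scaled-occupancy v (∈supp d v dv>0)) at-v ⟩
        (a * (c * occ H v) + b * Σnb v (λ u → c * occ H u)) + (a * d′ v + b * Σnb v d′)
          ≡⟨ solve 6 (λ a b x y z w → (a :* x :+ b :* y) :+ (a :* z :+ b :* w) := a :* (x :+ z) :+ b :* (y :+ w))
               refl a b (c * occ H v) (Σnb v (λ u → c * occ H u)) (d′ v) (Σnb v d′) ⟩
        a * (c * occ H v + d′ v) + b * (Σnb v (λ u → c * occ H u) + Σnb v d′)
          ≡⟨ cong₂ (λ x y → a * x + b * y) (d′+c·occ v)
                   (trans (sym (Σnb-+ v (λ u → c * occ H u) d′)) (Σnb-cong v d′+c·occ)) ⟩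
        a * d v + b * Σnb v d                       ∎)
        where
        open ≤-Reasoning
        dv>0 : 0ℚ < d v
        dv>0 = <-≤-trans d′v>0 (d′≤d v)

      extend : Cover d′ → Cover d
      extend R′ = record { w = w ; w-0≤ = w-0≤ ; exact = exact ; on-indep = on-indep ; charged = charged }
        where
        open Cover R′ renaming (w to w′; w-0≤ to w′-0≤; exact to exact′; on-indep to on-indep′; charged to charged′)
        w : Subset n → ℚ
        w I = c * hc H I + w′ I
        w-0≤ : ∀ I → 0ℚ ≤ w I
        w-0≤ I = 0≤+ (0≤* c-0≤ (hc-0≤ t≥0 H I)) (w′-0≤ I)
        exact : ∀ u → Σs (λ I → if lookup I u then w I else 0ℚ) ≡ d u
        exact u = begin
          Σs (λ I → if lookup I u then w I else 0ℚ)
            ≡⟨ Σs-cong (λ I → trans (if-+ (lookup I u) (c * hc H I) (w′ I))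
                                    (cong (_+ (if lookup I u then w′ I else 0ℚ)) (if-* (lookup I u) c (hc H I)))) ⟩
          Σs (λ I → c * (if lookup I u then hc H I else 0ℚ) + (if lookup I u then w′ I else 0ℚ))
            ≡⟨ Σs-+ (λ I → c * (if lookup I u then hc H I else 0ℚ)) (λ I → if lookup I u then w′ I else 0ℚ) ⟩
          Σs (λ I → c * (if lookup I u then hc H I else 0ℚ)) + Σs (λ I → if lookup I u then w′ I else 0ℚ)
            ≡⟨ cong₂ _+_ (Σs-* c (λ I → if lookup I u then hc H I else 0ℚ)) (exact′ u) ⟩
          c * occ H u + d′ u
            ≡⟨ d′+c·occ u ⟩
          d u ∎
          where open ≡-Reasoning
        on-indep : ∀ I → independentᵇ I ≡ false → w I ≡ 0ℚ
        on-indep I e rewrite on-indep′ I e = trans (+-identityʳ _) (trans (cong (c *_) hc≡0) (*-zeroʳ c))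
          where
          hc≡0 : hc H I ≡ 0ℚ
          hc≡0 with I ⊆ᵇ H
          ... | false = refl
          ... | true rewrite e = refl
        Σw : Σs w ≡ c * Z H + Σs w′
        Σw = trans (Σs-+ (λ I → c * hc H I) w′) (cong (_+ Σs w′) (Σs-* c (hc H)))
        charged : (Σs w ≡ 0ℚ) ⊎ Charged d (Σs w)
        charged = inj₂ (subst (Charged d) (sym Σw) (charge (Σs w′) charged′))

    -- Iterate the greedy step; the support shrinks each time.
    cover-by-size : ∀ m d → (∀ u → 0ℚ ≤ d u) → card (supp d) ℕ.≤ m → Cover d
    cover-by-size m d d≥0 size with argmin (lookup (supp d)) (λ u → d u * recip (occ (supp d) u))
    ... | inj₁ none = zero-cover d d≥0 none
    cover-by-size zero d d≥0 size | inj₂ (v₀ , v₀∈H , min) = ⊥-elim (ℕP.<⇒≱ (card-pos (supp d) v₀ v₀∈H) size)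
    cover-by-size (suc m) d d≥0 size | inj₂ (v₀ , v₀∈H , min) =
      extend (cover-by-size m d′ d′-0≤ (ℕP.≤-pred (ℕP.≤-trans support-shrinks size)))
      where open Peel d d≥0 v₀ v₀∈H min

    cover : ∀ d → (∀ u → 0ℚ ≤ d u) → Cover d
    cover d d≥0 = cover-by-size n d d≥0 (card-≤ (supp d))

  -- Greedy extension of an independent set to a maximal one: scan the
  -- vertices, adding each one that has no neighbour in the current set.  After
  -- the scan every vertex is dominated, which is maximality.

  module MaximalExtension {n} (G : Graph n) where
    open GraphBasics G

    Dominated : Subset n → Fin n → Set
    Dominated T u = (lookup T u ≡ true) ⊎ Σ (Fin n) (λ x → (lookup T x ≡ true) × (adj G u x ≡ true))

    add : Subset n → Fin n → Subset n
    add S v = if lookup S v ∨ anyᵇ (λ x → lookup S x ∧ adj G v x) then S else S ∪ ⁅ v ⁆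

    record AddSpec (S : Subset n) (v : Fin n) (T : Subset n) : Set where
      field
        grows     : ∀ u → lookup S u ≡ true → lookup T u ≡ true
        dominates : Dominated T v
        keeps-ind : independentᵇ S ≡ true → independentᵇ T ≡ true

    add-spec : ∀ S v → AddSpec S v (add S v)
    add-spec S v with lookup S v in sv
    ... | true = record { grows = λ u e → e ; dominates = inj₁ sv ; keeps-ind = λ e → e }
    ... | false with anyᵇ (λ x → lookup S x ∧ adj G v x) in an
    ...   | true = record { grows = λ u e → e ; dominates = inj₂ (x , ∧-true {lookup S x} q) ; keeps-ind = λ e → e }
      where
      x = proj₁ (anyᵇ-sound (λ x → lookup S x ∧ adj G v x) an)
      q = proj₂ (anyᵇ-sound (λ x → lookup S x ∧ adj G v x) an)
    ...   | false = record
      { grows = λ u e → ∈∪ˡ S ⁅ v ⁆ u e ; dominates = inj₁ (∈∪ʳ S ⁅ v ⁆ v (∈⁅⁆ v)) ; keeps-ind = keeps }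
      where
      v-free : ∀ x → lookup S x ≡ true → adj G v x ≡ false
      v-free x sx with adj G v x in vx
      ... | false = refl
      ... | true = ⊥-elim (t≢f (trans (sym (anyᵇ-complete (λ x → lookup S x ∧ adj G v x) x (∧-intro sx vx))) an))
      keeps : independentᵇ S ≡ true → independentᵇ (S ∪ ⁅ v ⁆) ≡ true
      keeps S-ind = independentᵇ-complete (S ∪ ⁅ v ⁆) ind
        where
        ind : ∀ u x → lookup (S ∪ ⁅ v ⁆) u ≡ true → lookup (S ∪ ⁅ v ⁆) x ≡ true → adj G u x ≡ false
        ind u x p q with ∈∪-cases S ⁅ v ⁆ u p | ∈∪-cases S ⁅ v ⁆ x q
        ... | inj₁ su | inj₁ sx = independentᵇ-sound S S-ind u x su sx
        ... | inj₂ vu | inj₁ sx with ∈⁅⁆⇒≡ v u vu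
        ...   | refl = v-free x sx
        ind u x p q | inj₁ su | inj₂ vx with ∈⁅⁆⇒≡ v x vx
        ...   | refl = trans (Graph.sym G u v) (v-free u su)
        ind u x p q | inj₂ vu | inj₂ vx with ∈⁅⁆⇒≡ v u vu | ∈⁅⁆⇒≡ v x vx
        ...   | refl | refl = Graph.irrefl G v

    add-all : List (Fin n) → Subset n → Subset n
    add-all [] S = S
    add-all (v ∷ vs) S = add-all vs (add S v)

    add-all-grows : ∀ vs S u → lookup S u ≡ true → lookup (add-all vs S) u ≡ true
    add-all-grows [] S u e = e
    add-all-grows (v ∷ vs) S u e = add-all-grows vs (add S v) u (AddSpec.grows (add-spec S v) u e)

    add-all-keeps-ind : ∀ vs S → independentᵇ S ≡ true → independentᵇ (add-all vs S) ≡ true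
    add-all-keeps-ind [] S e = e
    add-all-keeps-ind (v ∷ vs) S e = add-all-keeps-ind vs (add S v) (AddSpec.keeps-ind (add-spec S v) e)

    add-all-dominates : ∀ vs S u → u ∈ vs → Dominated (add-all vs S) u
    add-all-dominates (v ∷ vs) S u (here refl) with AddSpec.dominates (add-spec S u)
    ... | inj₁ e = inj₁ (add-all-grows vs (add S u) u e)
    ... | inj₂ (x , sx , ux) = inj₂ (x , add-all-grows vs (add S u) x sx , ux)
    add-all-dominates (v ∷ vs) S u (there m) = add-all-dominates vs (add S v) u m

    maximalise : Subset n → Subset n
    maximalise I = add-all (allFin n) I

    ⊆maximalise : ∀ I u → lookup I u ≡ true → lookup (maximalise I) u ≡ true
    ⊆maximalise I = add-all-grows (allFin n) I

    maximalise-maximal : ∀ I → independentᵇ I ≡ true → MaximalIndependent G (maximalise I)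
    maximalise-maximal I I-ind = independent , maximal
      where
      M = maximalise I
      M-ind : independentᵇ M ≡ true
      M-ind = add-all-keeps-ind (allFin n) I I-ind
      independent : Independent G M
      independent u v p q = independentᵇ-sound M M-ind u v ([]=⇒lookup p) ([]=⇒lookup q)
      maximal : ∀ T → Independent G T → M ⊆ T → T ≡ M
      maximal T T-ind M⊆T = subset-ext same
        where
        same : ∀ u → lookup T u ≡ lookup M u
        same u with lookup M u in mu
        ... | true = []=⇒lookup (M⊆T (lookup⇒[]= u M mu))
        ... | false with add-all-dominates (allFin n) I u (∈-allFin u)
        ...   | inj₁ e = ⊥-elim (t≢f (trans (sym e) mu))
        ...   | inj₂ (x , mx , ux) with lookup T u in tu
        ...     | false = refl
        ...     | true = ⊥-elim (t≢f (trans (sym ux) (T-ind u x (lookup⇒[]= u T tu) (M⊆T (lookup⇒[]= x M mx)))))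

  -- From a fractional cover by independent sets to a fractional colouring:
  -- push the weight of each independent I onto its maximal extension M, and
  -- cap each M's weight at 1 (no vertex loses coverage, since coverage ≥ 1
  -- and truncation at 1 is subadditive).

  module ColouringFromCover {n} (G : Graph n) (w : Subset n → ℚ) (w-0≤ : ∀ I → 0ℚ ≤ w I)
    (on-indep : ∀ I → GraphBasics.independentᵇ G I ≡ false → w I ≡ 0ℚ)
    (covers : ∀ v → 1ℚ ≤ Σs (λ I → if lookup I v then w I else 0ℚ)) where
    open GraphBasics G
    open MaximalExtension G

    pushed : Subset n → ℚ
    pushed M = Σs (λ I → if maximalise I ≡ᵇ M then w I else 0ℚ)

    pushed-0≤ : ∀ M → 0ℚ ≤ pushed M
    pushed-0≤ M = Σs-0≤ (λ I → 0≤if (maximalise I ≡ᵇ M) (w-0≤ I))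

    capped : Subset n → ℚ
    capped M = 1ℚ ⊓ pushed M

    regroup : ∀ (h : Subset n → Bool) →
      Σs (λ M → if h M then pushed M else 0ℚ) ≡ Σs (λ I → if h (maximalise I) then w I else 0ℚ)
    regroup h = begin
      Σs (λ M → if h M then pushed M else 0ℚ)
        ≡⟨ Σs-cong (λ M → if-Σs (h M) (λ I → if maximalise I ≡ᵇ M then w I else 0ℚ)) ⟩
      Σs (λ M → Σs (λ I → g M I))
        ≡⟨ sum-swap (allSubsets n) (allSubsets n) g ⟩
      Σs (λ I → Σs (λ M → g M I))
        ≡⟨ Σs-cong collapse ⟩
      Σs (λ I → if h (maximalise I) then w I else 0ℚ) ∎
      where
      open ≡-Reasoning
      g : Subset n → Subset n → ℚ
      g M I = if h M then (if maximalise I ≡ᵇ M then w I else 0ℚ) else 0ℚ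
      if-Σs : ∀ (b : Bool) (f : Subset n → ℚ) → (if b then Σs f else 0ℚ) ≡ Σs (λ I → if b then f I else 0ℚ)
      if-Σs true f = refl
      if-Σs false f = sym (Σs-0 {n} (λ _ → refl))
      collapse : ∀ I → Σs (λ M → g M I) ≡ (if h (maximalise I) then w I else 0ℚ)
      collapse I = trans (Σs-cong (λ M → trans (if-swap (h M) (maximalise I ≡ᵇ M) (w I))
                                               (cong (if_then (if h M then w I else 0ℚ) else 0ℚ) (≡ᵇ-sym (maximalise I) M))))
                         (Σs-point (maximalise I) (λ M → if h M then w I else 0ℚ))

    capped-support : ∀ M → ¬ (capped M ≡ 0ℚ) → MaximalIndependent G M
    capped-support M capped≢0 with sum-nonzero (allSubsets n) pushed≢0
      where
      pushed≢0 : ¬ (pushed M ≡ 0ℚ)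
      pushed≢0 e = capped≢0 (trans (cong (1ℚ ⊓_) e) (p≥q⇒p⊓q≡q 0≤1))
    ... | I , term≢0 with maximalise I ≡ᵇ M in eq
    ...   | false = ⊥-elim (term≢0 refl)
    ...   | true with independentᵇ I in ind
    ...     | false = ⊥-elim (term≢0 (on-indep I ind))
    ...     | true = subst (MaximalIndependent G) (≡ᵇ-sound eq) (maximalise-maximal I ind)

    capped-covers : ∀ v → 1ℚ ≤ Σs (λ M → if lookup M v then capped M else 0ℚ)
    capped-covers v = begin
      1ℚ                                                  ≡⟨ sym (p≤q⇒p⊓q≡p 1≤X) ⟩
      1ℚ ⊓ X                                              ≤⟨ sum-1⊓ (allSubsets n) (λ M → 0≤if (lookup M v) (pushed-0≤ M)) ⟩
      Σs (λ M → 1ℚ ⊓ (if lookup M v then pushed M else 0ℚ)) ≤⟨ Σs-mono cap ⟩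
      Σs (λ M → if lookup M v then capped M else 0ℚ)      ∎
      where
      open ≤-Reasoning
      X = Σs (λ M → if lookup M v then pushed M else 0ℚ)
      cap : ∀ M → 1ℚ ⊓ (if lookup M v then pushed M else 0ℚ) ≤ (if lookup M v then capped M else 0ℚ)
      cap M with lookup M v
      ... | true = ≤-refl
      ... | false = p⊓q≤q 1ℚ 0ℚ
      extended : ∀ I → (if lookup I v then w I else 0ℚ) ≤ (if lookup (maximalise I) v then w I else 0ℚ)
      extended I with lookup I v in iv
      ... | true rewrite ⊆maximalise I v iv = ≤-refl
      ... | false = 0≤if (lookup (maximalise I) v) (w-0≤ I)
      1≤X : 1ℚ ≤ X
      1≤X = ≤-trans (covers v) (≤-trans (Σs-mono extended) (≤-reflexive (sym (regroup (λ M → lookup M v)))))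

    colouring : FractionalColouring G
    colouring = record
      { w = capped ; w≥0 = λ M → ⊓-glb 0≤1 (pushed-0≤ M) ; w≤1 = λ M → p⊓q≤p 1ℚ (pushed M)
      ; support = capped-support ; covers = capped-covers }

    colouring-weight : totalWeight colouring ≤ Σs w
    colouring-weight = ≤-trans (Σs-mono (λ M → p⊓q≤q 1ℚ (pushed M))) (≤-reflexive (regroup (λ _ → true)))

  ≤-bound : ∀ (Δ k : ℕ) (t : ℚ) .{{_ : Positive t}} (W : ℚ) →
    t * (1ℚ + ℕ→ℚ k * t) * W ≤ (t * (1ℚ + ℕ→ℚ k * t) + (1ℚ + t) ^ℚ k) + t * (1ℚ + t) * ℕ→ℚ Δ →
    W ≤ bound Δ k t
  ≤-bound Δ k t W le = *-cancelˡ-≤-pos D {{denom-pos k t}} (≤-trans le (≤-reflexive (sym D·bound)))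
    where
    D = t * (1ℚ + ℕ→ℚ k * t)
    num = ((1ℚ + t) ^ℚ k) + t * (1ℚ + t) * ℕ→ℚ Δ
    instance
      D≢0 : NonZero D
      D≢0 = pos⇒nonZero D {{denom-pos k t}}
    D·bound : D * bound Δ k t ≡ (D + (1ℚ + t) ^ℚ k) + t * (1ℚ + t) * ℕ→ℚ Δ
    D·bound = begin
      D * (1ℚ + num * (1/ D))   ≡⟨ solve 3 (λ d x i → d :* (con 1ℚ :+ x :* i) := d :+ x :* (d :* i)) refl D num (1/ D) ⟩
      D + num * (D * (1/ D))    ≡⟨ cong (λ z → D + num * z) (*-inverseʳ D) ⟩
      D + num * 1ℚ              ≡⟨ solve 4 (λ d p b δ → d :+ (p :+ b :* δ) :* con 1ℚ := (d :+ p) :+ b :* δ)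
                                     refl D ((1ℚ + t) ^ℚ k) (t * (1ℚ + t)) (ℕ→ℚ Δ) ⟩
      (D + (1ℚ + t) ^ℚ k) + t * (1ℚ + t) * ℕ→ℚ Δ ∎
      where open ≡-Reasoning

  -- The theorem: cover the all-ones demand greedily, charge its total weight
  -- to one vertex (where the demand is 1 and the neighbourhood demand is at
  -- most Δ), and turn the cover into a fractional colouring.
  χf-bound : ∀ {n} (G : Graph n) → TriangleFree G → (k : ℕ) (t : ℚ) .{{_ : Positive t}} →
    χf≤ G (bound (maxDegree G) k t)
  χf-bound G tf k t = colouring , ≤-trans colouring-weight (≤-bound (maxDegree G) k t (Σs w) charged-bound)
    where
    open GraphBasics G
    open LocalOccupancy G tf t k
    open GreedyCovering G tf t k (positive⁻¹ t)
    open Cover (cover (λ _ → 1ℚ) (λ _ → 0≤1))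
    open ColouringFromCover G w w-0≤ on-indep (λ v → ≤-reflexive (sym (exact v)))
    a+bΔ-0≤ : 0ℚ ≤ a + b * ℕ→ℚ (maxDegree G)
    a+bΔ-0≤ = 0≤+ a-0≤ (0≤* b-0≤ (ℕ→ℚ-0≤ (maxDegree G)))
    charged-bound : D * Σs w ≤ a + b * ℕ→ℚ (maxDegree G)
    charged-bound with charged
    ... | inj₁ Σw≡0 = ≤-trans (≤-reflexive (trans (cong (D *_) Σw≡0) (*-zeroʳ D))) a+bΔ-0≤
    ... | inj₂ (v , _ , at-v) = ≤-trans at-v (+-mono-≤ (≤-reflexive (*-identityʳ a)) (*-monoˡ-≤-0≤ b-0≤ (Σnb-1≤Δ v)))

open import Defs
open import Data.Nat using (ℕ; _≤_)
open import Data.Rational using (ℚ; Positive)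

theorem1p9 : ∀ {n} (G : Graph n) → TriangleFree G →
    (k : ℕ) → 1 ≤ k → (t : ℚ) → .{{_ : Positive t}} →
    χf≤ G (bound (maxDegree G) k t)
theorem1p9 G triangle-free k _ t = HardCoreColouring.χf-bound G triangle-free k t
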